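{- For every digraph $D$, the following identities hold as identities of rational functions in $x,y,z$: \[ \widehat{\sigma\pi}(D;x,y,z)=\left(\frac{y-1}{z-1}\right)^{ -|V(D)|}\xi\!\left(D;\frac{y-1}{z-1},\,x\frac{y-1}{z-1},\,x\frac{(y-1)^2}{z-1}\right), \] \[ \xi(D;x,y,z)=x^{|V(D)|}\,\widehat{\sigma\pi}\!\left(D;\frac yx,\frac{y+z}{y},\frac{z}{xy}+1\right). \]
   Context: Digraphs are finite directed multigraphs; loops and multiple arcs are allowed. $E_n$ is the arcless digraph on $n$ vertices. The arc operations are as follows. $D_{ -e}$ deletes $e$. If $e=(u,v)$ with $u\ne v$, then $D_{/e}$ removes all arcs with tail $u$ and all arcs with head $v$ (including $e$), and then identifies $u$ and $v$ into one new vertex. If $e=(u,u)$ is a loop, then $D_{/e}$ deletes $u$ and its incident arcs. For $e=(u,v)$, $D_{\dagger e}$ deletes $u$, $v$ and all arcs incident to them. The arc elimination polynomial $\xi(D;x,y,z)$ is the (well-defined) digraph invariant given by the following rules: \[ \xi(D)=\xi(D_{ -e})+y\,\xi(D_{/e})+z\,\xi(D_{\dagger e}) \text{ for every arc } e, \] \[ \xi(D_1\cup D_2)=\xi(D_1)\xi(D_2),\qquad \xi(E_1)=x,\qquad \xi(E_0)=1. \] The trivariate cycle-path polynomial is \[ \widehat{\sigma\pi}(D;x,y,z)=\sum_F x^{|F|}y^{kc(D\langle F\rangle)}z^{kp(D\langle F\rangle)}, \] summed over all $F\subseteq E(D)$ in which every vertex has in-degree and out-degree at most 1 in the spanning subgraph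 $D\langle F\rangle=(V,F)$. Here $kc$ counts directed-cycle components (including loops), and $kp$ counts components that are directed paths with at least one arc. -}

module Defs where

open import Data.Nat as ℕ using (ℕ; zero; suc)
open import Data.Fin as Fin using (Fin; punchOut)
open import Data.Fin.Properties as FinP using ()
open import Data.Bool using (Bool; true; false; _∧_; _∨_; not; if_then_else_)
open import Data.List as List using (List; []; _∷_; length; filter; mapMaybe; allFin; foldr)
open import Data.Maybe using (Maybe; just; nothing)
open import Data.Product using (_×_; _,_; proj₁; proj₂; Σ)
open import Data.Empty using (⊥-elim)
open import Data.Bool.ListAction using (any; all)
open import Data.Rational as ℚ using (ℚ; 0ℚ; 1ℚ; _+_; _*_; _÷_)
open import Data.Rational.Properties as ℚP using ()
open import Relation.Nullary using (yes; no; ¬_)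
open import Relation.Nullary.Decidable using (⌊_⌋; ¬?; _×-dec_; T?)
open import Relation.Binary.PropositionalEquality using (_≡_; _≢_; refl; ≢-sym)

-- Digraphs: finite directed multigraphs on vertex set Fin n.
-- Arcs form a list (so parallel arcs and loops are allowed; each list
-- entry is a distinct arc).

record Digraph : Set where
  constructor digraph
  field
    nV   : ℕ
    arcs : List (Fin nV × Fin nV)
open Digraph public

Arc : ℕ → Set
Arc n = Fin n × Fin n

pow : ℚ → ℕ → ℚ
pow x zero    = 1ℚ
pow x (suc n) = x * pow x n

-- total division: p /ₜ q = p ÷ q when q ≠ 0 (and 0 otherwise; only used
-- under hypotheses guaranteeing nonzero denominators)
_/ₜ_ : ℚ → ℚ → ℚ
p /ₜ q with q ℚP.≟ 0ℚ
... | yes _  = 0ℚ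
... | no q≢0 = _÷_ p q {{ℚ.≢-nonZero q≢0}}

_==_ : ∀ {n} → Fin n → Fin n → Bool
a == b = ⌊ a FinP.≟ b ⌋

delVertex : ∀ {m} → Fin (suc m) → List (Arc (suc m)) → List (Arc m)
delVertex {m} w = mapMaybe f
  where
  f : Arc (suc m) → Maybe (Arc m)
  f (a , b) with a FinP.≟ w | b FinP.≟ w
  ... | no a≢w | no b≢w = just (punchOut (≢-sym a≢w) , punchOut (≢-sym b≢w))
  ... | _      | _      = nothing

-- identify v into u (u ≢ v): vertex v is removed and renamed to u
mergeInto : ∀ {m} {u v : Fin (suc m)} → u ≢ v → Fin (suc m) → Fin m
mergeInto {m} {u} {v} u≢v w with w FinP.≟ v
... | yes _  = punchOut (≢-sym u≢v)
... | no w≢v = punchOut (≢-sym w≢v)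

-- D_{/e} for e = (u,v), u ≢ v: remove all arcs with tail u and all arcs
-- with head v (including e), then identify u and v
contractArcs : ∀ {m} {u v : Fin (suc m)} → u ≢ v →
               List (Arc (suc m)) → List (Arc m)
contractArcs {m} {u} {v} u≢v es =
  List.map (λ { (a , b) → mergeInto u≢v a , mergeInto u≢v b })
    (filter (λ { (a , b) → ¬? (a FinP.≟ u) ×-dec ¬? (b FinP.≟ v) }) es)

-- D_{†e} for e = (u,v), u ≢ v: delete u, v and all incident arcs
daggerArcs : ∀ {m} {u v : Fin (suc m)} → u ≢ v → List (Arc (suc m)) →
             Σ ℕ (λ k → List (Arc k))
daggerArcs {zero}   {Fin.zero} {Fin.zero} u≢v es = ⊥-elim (u≢v refl)
daggerArcs {suc m′} {u}    {v}    u≢v es =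
  m′ , delVertex (punchOut {i = u} {j = v} u≢v) (delVertex u es)

-- Defined by the recurrence applied to the first arc of the list
-- (well-definedness, i.e. independence of the chosen arc, is the
-- paper's claim), with ξ(E_n) = x^n (from multiplicativity and ξ(E_1)=x).

ξfuel : ℚ → ℚ → ℚ → ℕ → (n : ℕ) → List (Arc n) → ℚ
ξfuel x y z _       n       []               = pow x n
ξfuel x y z zero    n       (_ ∷ _)          = 0ℚ   -- unreachable
ξfuel x y z (suc k) zero    ((() , _) ∷ es)
ξfuel x y z (suc k) (suc m) ((u , v) ∷ es) with u FinP.≟ v
-- loop e = (u,u): D_{/e} and D_{†e} both delete u and its incident arcs
... | yes _ =
      ξfuel x y z k (suc m) es
    + y * ξfuel x y z k m (delVertex u es)
    + z * ξfuel x y z k m (delVertex u es)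
... | no u≢v =
      ξfuel x y z k (suc m) es
    + y * ξfuel x y z k m (contractArcs u≢v es)
    + z * ξfuel x y z k (proj₁ (daggerArcs u≢v es)) (proj₂ (daggerArcs u≢v es))

ξ : Digraph → ℚ → ℚ → ℚ → ℚ
ξ D x y z = ξfuel x y z (length (arcs D)) (nV D) (arcs D)

subLists : ∀ {A : Set} → List A → List (List A)
subLists []       = [] ∷ []
subLists (a ∷ as) = let r = subLists as in r List.++ List.map (a ∷_) r

count : ∀ {A : Set} → (A → Bool) → List A → ℕ
count p xs = length (filter (λ a → T? (p a)) xs)

module _ {n : ℕ} (F : List (Arc n)) where

  outdeg indeg : Fin n → ℕ
  outdeg w = count (λ e → proj₁ e == w) F
  indeg  w = count (λ e → proj₂ e == w) F

  admissible : Bool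
  admissible = all (λ w → ⌊ outdeg w ℕ.≤? 1 ⌋ ∧ ⌊ indeg w ℕ.≤? 1 ⌋) (allFin n)

  adj : Fin n → Fin n → Bool
  adj a b = any (λ e → (proj₁ e == a ∧ proj₂ e == b) ∨ (proj₁ e == b ∧ proj₂ e == a)) F

  reach : ℕ → Fin n → Fin n → Bool
  reach zero    a b = a == b
  reach (suc k) a b = reach k a b ∨ any (λ c → reach k a c ∧ adj c b) (allFin n)

  conn : Fin n → Fin n → Bool
  conn = reach n

  -- a is the least vertex of its component (one root per component)
  isRoot : Fin n → Bool
  isRoot a = not (any (λ b → ⌊ b Fin.<? a ⌋ ∧ conn a b) (allFin n))

  comp : Fin n → List (Fin n)
  comp a = filter (λ b → T? (conn a b)) (allFin n)

  -- (in a subgraph with all in/out-degrees ≤ 1) the component of a is a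
  -- directed cycle (including loops): every vertex has in- and out-degree 1
  isCycleComp : Fin n → Bool
  isCycleComp a = all (λ b → ⌊ indeg b ℕ.≟ 1 ⌋ ∧ ⌊ outdeg b ℕ.≟ 1 ⌋) (comp a)

  -- ... is a directed path with at least one arc: it has an arc and a
  -- vertex of in-degree 0
  isPathComp : Fin n → Bool
  isPathComp a = any (λ b → ⌊ outdeg b ℕ.≟ 1 ⌋) (comp a)
               ∧ any (λ b → ⌊ indeg b ℕ.≟ 0 ⌋) (comp a)

  kc kp : ℕ
  kc = count (λ a → isRoot a ∧ isCycleComp a) (allFin n)
  kp = count (λ a → isRoot a ∧ isPathComp a) (allFin n)

σπ : Digraph → ℚ → ℚ → ℚ → ℚ
σπ D x y z =
  foldr (λ F acc → (if admissible F
                     then pow x (length F) * pow y (kc F) * pow z (kp F)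
                     else 0ℚ) + acc)
        0ℚ (subLists (arcs D))

module Submission where

open import Defs
open import Data.Product using (_×_)
open import Data.Rational using (ℚ; 0ℚ; 1ℚ; _+_; _-_; _*_)
open import Relation.Binary.PropositionalEquality using (_≡_; _≢_)

open import Data.Nat as N using (ℕ; zero; suc; z≤n; s≤s)
import Data.Nat.Properties as NP
open import Data.Fin as Fin using (Fin; punchOut; punchIn)
import Data.Fin.Properties as FP
open import Data.Bool using (Bool; true; false; _∧_; _∨_; not; if_then_else_; T)
open import Data.Bool.Properties using (∧-identityʳ; ∧-zeroʳ; ∨-comm; ∧-distribˡ-∨)
open import Data.Bool.ListAction using (any; all)
open import Data.List as L using (List; []; _∷_; length; filter; allFin; foldr; map; _++_)
import Data.List.Properties as LP
open import Data.List.Relation.Unary.All as All using (All; []; _∷_)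
open import Data.List.Relation.Unary.Any using (here; there)
open import Data.List.Membership.Propositional using (_∈_)
open import Data.List.Membership.Propositional.Properties using (∈-allFin; ∈-map⁺; ∈-map⁻)
open import Data.Product using (Σ; _,_; proj₁; proj₂)
open import Data.Sum using (_⊎_; inj₁; inj₂)
open import Data.Empty using (⊥; ⊥-elim)
open import Data.Unit using (tt)
import Data.Rational as Q
import Data.Rational.Properties as QP
open import Data.Rational.Solver using (module +-*-Solver)
open +-*-Solver using (solve; _:+_; _:*_; con; _:=_)
open import Relation.Nullary using (yes; no; ¬_; Dec; does)
open import Relation.Unary using (Decidable)
open import Relation.Nullary.Decidable using (⌊_⌋; T?; dec-true; dec-false; toWitness; fromWitness)
open import Relation.Binary.PropositionalEquality using (refl; sym; trans; cong; cong₂; subst; ≢-sym; module ≡-Reasoning)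
open import Function using (_∘_; id)

-- Both identities are instances of one fact: the cycle-path sum obeys the
-- deletion–contraction recurrence of ξ after rescaling.  For a loop e at u,
-- the subgraphs using e are those of D − u together with one more cycle, so
--   σπ(D) = σπ(D − e) + XY·σπ(D − u).
-- For an arc e = (u,v), u ≠ v, a subgraph F ∋ e must avoid the other arcs out
-- of u and into v, and then corresponds to its image in D/e.  Contracting e
-- preserves all components and the number of cycles, and loses one path
-- exactly when the merged vertex ends up isolated, i.e. when F − e lives in
-- D†e; hence
--   σπ(D) = σπ(D − e) + X·σπ(D/e) + X(Z − 1)·σπ(D†e).
-- Multiplying by a^|V| turns this into the recurrence defining ξ with the
-- parameters (a, aX, a²X(Z − 1)) whenever aXY = aX + a²X(Z − 1); both
-- substitutions of the theorem are of this form.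

variable
  A B : Set

T-ext : ∀ {a b : Bool} → (T a → T b) → (T b → T a) → a ≡ b
T-ext {false} {false} f g = refl
T-ext {false} {true} f g = ⊥-elim (g tt)
T-ext {true} {false} f g = ⊥-elim (f tt)
T-ext {true} {true} f g = refl

∧-intro : ∀ {a b} → T a → T b → T (a ∧ b)
∧-intro {true} {true} _ _ = tt

∧-elimˡ : ∀ {a b} → T (a ∧ b) → T a
∧-elimˡ {true} _ = tt

∧-elimʳ : ∀ {a b} → T (a ∧ b) → T b
∧-elimʳ {true} {true} _ = tt

∨-introˡ : ∀ {a} b → T a → T (a ∨ b)
∨-introˡ {true} _ _ = tt

∨-introʳ : ∀ a {b} → T b → T (a ∨ b)
∨-introʳ true _ = tt
∨-introʳ false t = t

∨-elim : ∀ {a b} → T (a ∨ b) → T a ⊎ T b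
∨-elim {true} _ = inj₁ tt
∨-elim {false} t = inj₂ t

not-intro : ∀ {a} → ¬ T a → T (not a)
not-intro {false} _ = tt
not-intro {true} f = f tt

not-elim : ∀ {a} → T (not a) → ¬ T a
not-elim {false} _ ()
not-elim {true} ()

¬T⇒≡false : ∀ {a} → ¬ T a → a ≡ false
¬T⇒≡false {false} _ = refl
¬T⇒≡false {true} f = ⊥-elim (f tt)

T⇒≡true : ∀ {a} → T a → a ≡ true
T⇒≡true {true} _ = refl

cong₃ : ∀ {C D E F : Set} (f : C → D → E → F) {c c′ d d′ e e′} → c ≡ c′ → d ≡ d′ → e ≡ e′ → f c d e ≡ f c′ d′ e′
cong₃ f refl refl refl = refl

any-intro : (p : A → Bool) {x : A} (xs : List A) → x ∈ xs → T (p x) → T (any p xs)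
any-intro p (y ∷ xs) (here refl) t = ∨-introˡ (any p xs) t
any-intro p (y ∷ xs) (there m) t = ∨-introʳ (p y) (any-intro p xs m t)

any-elim : (p : A → Bool) (xs : List A) → T (any p xs) → Σ A λ x → x ∈ xs × T (p x)
any-elim p (y ∷ xs) t with ∨-elim {p y} t
... | inj₁ t1 = y , here refl , t1
... | inj₂ t2 with any-elim p xs t2
... | x , m , tx = x , there m , tx

all-intro : (p : A → Bool) (xs : List A) → (∀ x → x ∈ xs → T (p x)) → T (all p xs)
all-intro p [] f = tt
all-intro p (y ∷ xs) f = ∧-intro (f y (here refl)) (all-intro p xs (λ x m → f x (there m)))

all-elim : (p : A → Bool) (xs : List A) → T (all p xs) → ∀ x → x ∈ xs → T (p x)
all-elim p (y ∷ xs) t x (here refl) = ∧-elimˡ t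
all-elim p (y ∷ xs) t x (there m) = all-elim p xs (∧-elimʳ {p y} t) x m

any-map : (p : B → Bool) (f : A → B) (xs : List A) → any p (map f xs) ≡ any (p ∘ f) xs
any-map p f [] = refl
any-map p f (x ∷ xs) = cong (p (f x) ∨_) (any-map p f xs)

any-cong : (p q : A → Bool) (xs : List A) → (∀ x → p x ≡ q x) → any p xs ≡ any q xs
any-cong p q [] e = refl
any-cong p q (x ∷ xs) e = cong₂ _∨_ (e x) (any-cong p q xs e)

any-none : (p : A → Bool) (xs : List A) → (∀ x → p x ≡ false) → any p xs ≡ false
any-none p [] e = refl
any-none p (x ∷ xs) e = cong₂ _∨_ (e x) (any-none p xs e)

all-counterexample : (q : A → Bool) (xs : List A) → ¬ T (all q xs) → Σ A λ x → x ∈ xs × ¬ T (q x)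
all-counterexample q [] f = ⊥-elim (f tt)
all-counterexample q (x ∷ xs) f with q x in eq
... | false = x , here refl , (λ t → subst T eq t)
... | true with all-counterexample q xs f
... | y , m , ny = y , there m , ny

𝟙 : Bool → ℕ
𝟙 true = 1
𝟙 false = 0

count-∷ : (p : A → Bool) (x : A) (xs : List A) → count p (x ∷ xs) ≡ 𝟙 (p x) N.+ count p xs
count-∷ p x xs with p x
... | true = refl
... | false = refl

count-cong-∈ : (p q : A → Bool) (xs : List A) → (∀ x → x ∈ xs → p x ≡ q x) → count p xs ≡ count q xs
count-cong-∈ p q [] e = refl
count-cong-∈ p q (x ∷ xs) e = begin
    count p (x ∷ xs)             ≡⟨ count-∷ p x xs ⟩
    𝟙 (p x) N.+ count p xs       ≡⟨ cong₂ N._+_ (cong 𝟙 (e x (here refl))) (count-cong-∈ p q xs (λ y m → e y (there m))) ⟩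
    𝟙 (q x) N.+ count q xs       ≡⟨ count-∷ q x xs ⟨
    count q (x ∷ xs)             ∎
  where open ≡-Reasoning

count-cong : (p q : A → Bool) (xs : List A) → (∀ x → p x ≡ q x) → count p xs ≡ count q xs
count-cong p q xs e = count-cong-∈ p q xs (λ x _ → e x)

count-congAll : (p q : A → Bool) (xs : List A) {P : A → Set} → All P xs → (∀ x → P x → p x ≡ q x) → count p xs ≡ count q xs
count-congAll p q xs al f = count-cong-∈ p q xs (λ x m → f x (All.lookup al m))

count-map : (p : B → Bool) (f : A → B) (xs : List A) → count p (map f xs) ≡ count (p ∘ f) xs
count-map p f [] = refl
count-map p f (x ∷ xs) = begin
    count p (map f (x ∷ xs))           ≡⟨ count-∷ p (f x) (map f xs) ⟩
    𝟙 (p (f x)) N.+ count p (map f xs) ≡⟨ cong (𝟙 (p (f x)) N.+_) (count-map p f xs) ⟩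
    𝟙 (p (f x)) N.+ count (p ∘ f) xs   ≡⟨ count-∷ (p ∘ f) x xs ⟨
    count (p ∘ f) (x ∷ xs)             ∎
  where open ≡-Reasoning

count-split : (p q : A → Bool) (xs : List A) →
  count p xs ≡ count (λ x → p x ∧ q x) xs N.+ count (λ x → p x ∧ not (q x)) xs
count-split p q [] = refl
count-split p q (x ∷ xs) with p x | q x | count-split p q xs
... | true  | true  | ih = cong suc ih
... | true  | false | ih = trans (cong suc ih) (sym (NP.+-suc _ _))
... | false | _     | ih = ih

count-all-false : (p : A → Bool) (xs : List A) → All (λ x → p x ≡ false) xs → count p xs ≡ 0
count-all-false p [] _ = refl
count-all-false p (x ∷ xs) (e ∷ es) = trans (count-∷ p x xs) (cong₂ N._+_ (cong 𝟙 e) (count-all-false p xs es))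

count-none : (p : A → Bool) (xs : List A) → (∀ x → p x ≡ false) → count p xs ≡ 0
count-none p xs e = count-all-false p xs (All.universal e xs)

count≡0⇒none : (p : A → Bool) (xs : List A) → count p xs ≡ 0 → All (λ x → ¬ T (p x)) xs
count≡0⇒none p [] _ = []
count≡0⇒none p (x ∷ xs) e with p x in eq
... | true = ⊥-elim (NP.1+n≢0 e)
... | false = (λ t → subst T eq t) ∷ count≡0⇒none p xs e

count-const∧ : (k : Bool) (g : A → Bool) (xs : List A) → count (λ x → k ∧ g x) xs ≡ 𝟙 k N.* count g xs
count-const∧ true g xs = sym (NP.+-identityʳ _)
count-const∧ false g xs = count-none (λ x → false) xs (λ _ → refl)

count≤length : (p : A → Bool) (xs : List A) → count p xs N.≤ length xs
count≤length p xs = LP.length-filter (λ a → T? (p a)) xs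

count-mono : (p q : A → Bool) (xs : List A) → (∀ x → T (p x) → T (q x)) → count p xs N.≤ count q xs
count-mono p q [] f = z≤n
count-mono p q (x ∷ xs) f with p x in eq | q x in eq2
... | true | true = s≤s (count-mono p q xs f)
... | true | false = ⊥-elim (subst T eq2 (f x (subst T (sym eq) tt)))
... | false | true = NP.m≤n⇒m≤1+n (count-mono p q xs f)
... | false | false = count-mono p q xs f

count-mono-< : (p q : A → Bool) (xs : List A) → (∀ x → T (p x) → T (q x)) →
  (y : A) → y ∈ xs → T (q y) → ¬ T (p y) → count p xs N.< count q xs
count-mono-< p q (x ∷ xs) f y (here refl) ty ny with p x in eq | q x in eq2
... | true | _ = ⊥-elim (ny tt)
... | false | true = s≤s (count-mono p q xs f)
... | false | false = ⊥-elim ty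
count-mono-< p q (x ∷ xs) f y (there m) ty ny with p x in eq | q x in eq2
... | true | true = s≤s (count-mono-< p q xs f y m ty ny)
... | true | false = ⊥-elim (subst T eq2 (f x (subst T (sym eq) tt)))
... | false | true = NP.m≤n⇒m≤1+n (count-mono-< p q xs f y m ty ny)
... | false | false = count-mono-< p q xs f y m ty ny

count-pos : (p : A → Bool) (xs : List A) (x : A) → x ∈ xs → T (p x) → 1 N.≤ count p xs
count-pos p xs x m t = subst (λ k → suc k N.≤ count p xs) (count-none (λ _ → false) xs (λ _ → refl))
  (count-mono-< (λ _ → false) p xs (λ _ ()) x m t (λ ()))

count-witness : (p : A → Bool) (xs : List A) → 1 N.≤ count p xs → Σ A λ x → x ∈ xs × T (p x)
count-witness p (x ∷ xs) le with p x in eq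
... | true = x , here refl , subst T (sym eq) tt
... | false with count-witness p xs le
... | y , m , t = y , there m , t

count-∨ : (p q : A → Bool) (xs : List A) → (∀ x → T (p x) → T (q x) → ⊥) →
  count (λ x → p x ∨ q x) xs ≡ count p xs N.+ count q xs
count-∨ p q [] dis = refl
count-∨ p q (x ∷ xs) dis with p x in ep | q x in eq | count-∨ p q xs dis
... | true  | true  | _  = ⊥-elim (dis x (subst T (sym ep) tt) (subst T (sym eq) tt))
... | true  | false | ih = cong suc ih
... | false | true  | ih = trans (cong suc ih) (sym (NP.+-suc _ _))
... | false | false | ih = ih

sumBy : (A → ℚ) → List A → ℚ
sumBy g = foldr (λ F acc → g F + acc) 0ℚ

onlyIf : Bool → ℚ → ℚ
onlyIf b q = if b then q else 0ℚ

sumBy-++ : (g : A → ℚ) (L1 L2 : List A) → sumBy g (L1 ++ L2) ≡ sumBy g L1 + sumBy g L2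
sumBy-++ g [] L2 = sym (QP.+-identityˡ _)
sumBy-++ g (F ∷ L1) L2 = trans (cong (g F +_) (sumBy-++ g L1 L2)) (sym (QP.+-assoc (g F) _ _))

sumBy-map : (g : B → ℚ) (f : A → B) (Ls : List A) → sumBy g (map f Ls) ≡ sumBy (g ∘ f) Ls
sumBy-map g f [] = refl
sumBy-map g f (F ∷ Ls) = cong (g (f F) +_) (sumBy-map g f Ls)

sumBy-cong : (g h : A → ℚ) (Ls : List A) → (∀ F → g F ≡ h F) → sumBy g Ls ≡ sumBy h Ls
sumBy-cong g h [] e = refl
sumBy-cong g h (F ∷ Ls) e = cong₂ _+_ (e F) (sumBy-cong g h Ls e)

sumBy-+ : (g h : A → ℚ) (Ls : List A) → sumBy (λ F → g F + h F) Ls ≡ sumBy g Ls + sumBy h Ls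
sumBy-+ g h [] = refl
sumBy-+ g h (F ∷ Ls) = begin
    (g F + h F) + sumBy (λ F → g F + h F) Ls ≡⟨ cong ((g F + h F) +_) (sumBy-+ g h Ls) ⟩
    (g F + h F) + (sumBy g Ls + sumBy h Ls)  ≡⟨ solve 4 (λ a b c d → (a :+ b) :+ (c :+ d) := (a :+ c) :+ (b :+ d)) refl (g F) (h F) (sumBy g Ls) (sumBy h Ls) ⟩
    (g F + sumBy g Ls) + (h F + sumBy h Ls)  ∎
  where open ≡-Reasoning

sumBy-* : (c : ℚ) (g : A → ℚ) (Ls : List A) → sumBy (λ F → c * g F) Ls ≡ c * sumBy g Ls
sumBy-* c g [] = sym (QP.*-zeroʳ c)
sumBy-* c g (F ∷ Ls) = trans (cong (c * g F +_) (sumBy-* c g Ls)) (sym (QP.*-distribˡ-+ c (g F) _))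

sumBy-zero : (g : A → ℚ) (Ls : List A) → (∀ F → g F ≡ 0ℚ) → sumBy g Ls ≡ 0ℚ
sumBy-zero g [] e = refl
sumBy-zero g (F ∷ Ls) e = cong₂ _+_ (e F) (sumBy-zero g Ls e)

sumBy-subLists-∷ : (g : List A → ℚ) (a : A) (L : List A) →
  sumBy g (subLists (a ∷ L)) ≡ sumBy g (subLists L) + sumBy (g ∘ (a ∷_)) (subLists L)
sumBy-subLists-∷ g a L = trans (sumBy-++ g (subLists L) _) (cong (sumBy g (subLists L) +_) (sumBy-map g (a ∷_) (subLists L)))

sumBy-subLists-∷-skip : (g : List A → ℚ) (a : A) (L : List A) → (∀ F → g (a ∷ F) ≡ 0ℚ) →
  sumBy g (subLists (a ∷ L)) ≡ sumBy g (subLists L)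
sumBy-subLists-∷-skip g a L z = begin
    sumBy g (subLists (a ∷ L))                                ≡⟨ sumBy-subLists-∷ g a L ⟩
    sumBy g (subLists L) + sumBy (g ∘ (a ∷_)) (subLists L)    ≡⟨ cong (sumBy g (subLists L) +_) (sumBy-zero _ (subLists L) z) ⟩
    sumBy g (subLists L) + 0ℚ                                 ≡⟨ QP.+-identityʳ _ ⟩
    sumBy g (subLists L)                                      ∎
  where open ≡-Reasoning

onlyIf-zero : ∀ b → onlyIf b 0ℚ ≡ 0ℚ
onlyIf-zero true = refl
onlyIf-zero false = refl

onlyIf-+ : ∀ b x y → onlyIf b (x + y) ≡ onlyIf b x + onlyIf b y
onlyIf-+ true x y = refl
onlyIf-+ false x y = refl

onlyIf-* : ∀ b c x → onlyIf b (c * x) ≡ c * onlyIf b x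
onlyIf-* true c x = refl
onlyIf-* false c x = sym (QP.*-zeroʳ c)

onlyIf-∧ : ∀ a b x → onlyIf a (onlyIf b x) ≡ onlyIf (a ∧ b) x
onlyIf-∧ true b x = refl
onlyIf-∧ false b x = refl

onlyIf-intro : ∀ b {x y} → (T b → x ≡ y) → (¬ T b → x ≡ 0ℚ) → x ≡ onlyIf b y
onlyIf-intro true if-true _ = if-true tt
onlyIf-intro false _ if-false = if-false (λ ())

onlyIf-absorb : ∀ a b x → (T b → T a) → onlyIf a (onlyIf b x) ≡ onlyIf b x
onlyIf-absorb true b x f = refl
onlyIf-absorb false true x f = ⊥-elim (f tt)
onlyIf-absorb false false x f = refl

module _ {n : ℕ} where
  ==-refl : (a : Fin n) → (a == a) ≡ true
  ==-refl a = T⇒≡true (fromWitness refl)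

  ==⇒≡ : {a b : Fin n} → T (a == b) → a ≡ b
  ==⇒≡ = toWitness

  ≡⇒== : {a b : Fin n} → a ≡ b → T (a == b)
  ≡⇒== = fromWitness

  ≢⇒==false : {a b : Fin n} → a ≢ b → (a == b) ≡ false
  ≢⇒==false ne = ¬T⇒≡false (ne ∘ toWitness)

≟⇒≡ : ∀ {k j} → T ⌊ k N.≟ j ⌋ → k ≡ j
≟⇒≡ {k} {j} = toWitness {a? = k N.≟ j}

≡⇒≟ : ∀ {k j} → k ≡ j → T ⌊ k N.≟ j ⌋
≡⇒≟ {k} {j} = fromWitness {a? = k N.≟ j}

module Connectivity {n : ℕ} (F : List (Arc n)) where

  adj-sym : (a b : Fin n) → adj F a b ≡ adj F b a
  adj-sym a b = any-cong _ _ F (λ e → ∨-comm (proj₁ e == a ∧ proj₂ e == b) _)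

  -- A record, so that k, a and b can be inferred from a proof.
  record Within (k : ℕ) (a b : Fin n) : Set where
    constructor within
    field unwithin : T (reach F k a b)
  open Within public

  within-suc : ∀ {k a b} → Within k a b → Within (suc k) a b
  within-suc {k} {a} {b} (within t) = within (∨-introˡ (any (λ c → reach F k a c ∧ adj F c b) (allFin n)) t)

  within-step : ∀ {k a c b} → Within k a c → T (adj F c b) → Within (suc k) a b
  within-step {k} {a} {c} {b} (within r) t = within (∨-introʳ (reach F k a b) (any-intro (λ c → reach F k a c ∧ adj F c b) (allFin n) (∈-allFin c) (∧-intro r t)))

  within-cases : ∀ {k a b} → Within (suc k) a b → Within k a b ⊎ Σ (Fin n) λ c → Within k a c × T (adj F c b)
  within-cases {k} {a} {b} (within t) with ∨-elim {reach F k a b} t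
  ... | inj₁ r = inj₁ (within r)
  ... | inj₂ r with any-elim (λ c → reach F k a c ∧ adj F c b) (allFin n) r
  ... | c , _ , tc = inj₂ (c , within (∧-elimˡ tc) , ∧-elimʳ {reach F k a c} tc)

  within-refl : ∀ k a → Within k a a
  within-refl zero a = within (≡⇒== refl)
  within-refl (suc k) a = within-suc (within-refl k a)

  within-+ : ∀ i {k a b} → Within k a b → Within (i N.+ k) a b
  within-+ zero r = r
  within-+ (suc i) r = within-suc (within-+ i r)

  within-trans : ∀ j k {a b c} → Within j a b → Within k b c → Within (k N.+ j) a c
  within-trans j zero r (within s) = subst (Within j _) (==⇒≡ s) r
  within-trans j (suc k) r s with within-cases s
  ... | inj₁ s' = within-suc (within-trans j k r s')
  ... | inj₂ (d , s' , t) = within-step (within-trans j k r s') t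

  within-sym : ∀ k {a b} → Within k a b → Within k b a
  within-sym zero (within r) = within (≡⇒== (sym (==⇒≡ r)))
  within-sym (suc k) {a} {b} r with within-cases r
  ... | inj₁ r' = within-suc (within-sym k r')
  ... | inj₂ (c , r' , t) = subst (λ i → Within i b a) (NP.+-comm k 1) (within-trans 1 k {b} {c} {a} (within-step (within-refl 0 b) (subst T (adj-sym c b) t)) (within-sym k r'))

  Stable : Fin n → ℕ → Set
  Stable a j = ∀ b → Within (suc j) a b → Within j a b

  stable-suc : ∀ {a j} → Stable a j → Stable a (suc j)
  stable-suc st b r with within-cases r
  ... | inj₁ r' = r'
  ... | inj₂ (c , r' , t) = within-step (st c r') t

  stable-up : ∀ {a j} → Stable a j → ∀ i → Stable a (i N.+ j)
  stable-up st zero = st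
  stable-up st (suc i) = stable-suc (stable-up st i)

  stable-down : ∀ {a j} → Stable a j → ∀ i {b} → Within (i N.+ j) a b → Within j a b
  stable-down st zero r = r
  stable-down st (suc i) r = stable-down st i (stable-up st i _ r)

  stable? : ∀ a j → Stable a j ⊎ Σ (Fin n) λ b → Within (suc j) a b × ¬ Within j a b
  stable? a j with T? (all (λ b → not (reach F (suc j) a b) ∨ reach F j a b) (allFin n))
  ... | yes t = inj₁ λ b r → within (h (all-elim _ (allFin n) t b (∈-allFin b)) (unwithin r))
    where
    h : ∀ {x y} → T (not x ∨ y) → T x → T y
    h {true} t _ = t
  ... | no nt with all-counterexample _ (allFin n) nt
  ... | b , _ , nb = inj₂ (b , within (h1 nb) , (λ r → h2 nb (unwithin r)))
    where
    h1 : ∀ {x y} → ¬ T (not x ∨ y) → T x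
    h1 {true} _ = tt
    h1 {false} f = ⊥-elim (f tt)
    h2 : ∀ {x y} → ¬ T (not x ∨ y) → ¬ T y
    h2 {true} {true} f _ = f tt
    h2 {false} f _ = f tt

  -- conn = reach n is transitive because the set of vertices within k steps of
  -- a grows strictly until it is stable, and it has at most n elements.
  stabilises-or-grows : ∀ a k → (Σ ℕ λ j → j N.≤ k × Stable a j) ⊎ (suc k N.≤ count (reach F k a) (allFin n))
  stabilises-or-grows a zero = inj₂ (count-pos (reach F zero a) (allFin n) a (∈-allFin a) (unwithin (within-refl 0 a)))
  stabilises-or-grows a (suc k) with stabilises-or-grows a k
  ... | inj₁ (j , j≤k , st) = inj₁ (j , NP.m≤n⇒m≤1+n j≤k , st)
  ... | inj₂ c with stable? a k
  ... | inj₁ st = inj₁ (k , NP.n≤1+n k , st)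
  ... | inj₂ (b , r1 , nr) = inj₂ (NP.≤-trans (s≤s c) (count-mono-< (reach F k a) (reach F (suc k) a) (allFin n) (λ x t → unwithin (within-suc {k} {a} {x} (within t))) b (∈-allFin b) (unwithin r1) (λ t → nr (within t))))

  stable-within-n : ∀ a → Σ ℕ λ j → j N.≤ n × Stable a j
  stable-within-n a with stabilises-or-grows a n
  ... | inj₁ s = s
  ... | inj₂ c = ⊥-elim (NP.<-irrefl refl (NP.≤-trans c (subst (count (reach F n a) (allFin n) N.≤_) (LP.length-tabulate id) (count≤length (reach F n a) (allFin n)))))

  within-mono : ∀ {k k'} {a b} → k N.≤ k' → Within k a b → Within k' a b
  within-mono {k} {k'} le r = subst (λ i → Within i _ _) (NP.m∸n+n≡m le) (within-+ (k' N.∸ k) r)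

  within⇒conn : ∀ k {a b} → Within k a b → T (conn F a b)
  within⇒conn k {a} {b} r with stable-within-n a
  ... | j , j≤n , st with NP.≤-total k j
  ... | inj₁ k≤j = unwithin (within-mono j≤n (within-mono k≤j r))
  ... | inj₂ j≤k = unwithin (within-mono j≤n (stable-down st (k N.∸ j) (subst (λ i → Within i a b) (sym (NP.m∸n+n≡m j≤k)) r)))

  conn-refl : ∀ a → T (conn F a a)
  conn-refl a = unwithin (within-refl n a)

  conn-sym : ∀ {a b} → T (conn F a b) → T (conn F b a)
  conn-sym t = unwithin (within-sym n (within t))

  conn-trans : ∀ {a b c} → T (conn F a b) → T (conn F b c) → T (conn F a c)
  conn-trans {a} {b} {c} r s = within⇒conn _ (within-trans n n {a} {b} {c} (within r) (within s))

  conn-step : ∀ {a c b} → T (conn F a c) → T (adj F c b) → T (conn F a b)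
  conn-step {a} {c} {b} r t = within⇒conn (suc n) (within-step {n} {a} {c} {b} (within r) t)

-- Counting equivalence classes by their least elements

suc<?suc : ∀ {n} (b d : Fin n) → ⌊ Fin.suc b Fin.<? Fin.suc d ⌋ ≡ ⌊ b Fin.<? d ⌋
suc<?suc b d with b Fin.<? d | Fin.suc b Fin.<? Fin.suc d
... | yes _ | yes _ = refl
... | no _ | no _ = refl
... | yes p | no q = ⊥-elim (q (s≤s p))
... | no p | yes (s≤s q) = ⊥-elim (p q)

<?zero : ∀ {n} (b : Fin (suc n)) → ⌊ b Fin.<? Fin.zero {n} ⌋ ≡ false
<?zero {n} b with b Fin.<? Fin.zero {n}
... | no _ = refl
... | yes ()

zero<?suc : ∀ {n} (d : Fin n) → ⌊ Fin.zero {n} Fin.<? Fin.suc d ⌋ ≡ true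
zero<?suc {n} b with Fin.zero {n} Fin.<? Fin.suc b
... | yes _ = refl
... | no p = ⊥-elim (p (s≤s z≤n))

allFin-suc : ∀ n → allFin (suc n) ≡ Fin.zero ∷ map Fin.suc (allFin n)
allFin-suc n = cong (Fin.zero ∷_) (sym (LP.map-tabulate id Fin.suc))

isFirst : (n : ℕ) → (Fin n → Bool) → Fin n → Bool
isFirst n Q d = Q d ∧ not (any (λ b → ⌊ b Fin.<? d ⌋ ∧ Q b) (allFin n))

isFirst-zero : ∀ n (Q : Fin (suc n) → Bool) → isFirst (suc n) Q Fin.zero ≡ Q Fin.zero
isFirst-zero n Q = trans (cong (λ t → Q Fin.zero ∧ not t) (any-none _ (allFin (suc n)) (λ b → cong (_∧ Q b) (<?zero b)))) (∧-identityʳ _)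

isFirst-suc : ∀ n (Q : Fin (suc n) → Bool) (d : Fin n) → isFirst (suc n) Q (Fin.suc d) ≡ Q (Fin.suc d) ∧ not (Q Fin.zero ∨ any (λ b → ⌊ b Fin.<? d ⌋ ∧ Q (Fin.suc b)) (allFin n))
isFirst-suc n Q d = cong (λ t → Q (Fin.suc d) ∧ not t) (begin
    any (λ b → ⌊ b Fin.<? Fin.suc d ⌋ ∧ Q b) (allFin (suc n)) ≡⟨ cong (any (λ b → ⌊ b Fin.<? Fin.suc d ⌋ ∧ Q b)) (allFin-suc n) ⟩
    (⌊ Fin.zero {n} Fin.<? Fin.suc d ⌋ ∧ Q Fin.zero) ∨ any (λ b → ⌊ b Fin.<? Fin.suc d ⌋ ∧ Q b) (map Fin.suc (allFin n))
      ≡⟨ cong₂ _∨_ (cong (_∧ Q Fin.zero) (zero<?suc d)) (trans (any-map _ Fin.suc (allFin n)) (any-cong _ _ (allFin n) (λ b → cong (_∧ Q (Fin.suc b)) (suc<?suc b d)))) ⟩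
    Q Fin.zero ∨ any (λ b → ⌊ b Fin.<? d ⌋ ∧ Q (Fin.suc b)) (allFin n) ∎)
  where open ≡-Reasoning

count-isFirst : ∀ n (Q : Fin n → Bool) (w : Fin n) → T (Q w) → count (isFirst n Q) (allFin n) ≡ 1
count-isFirst (suc n) Q w tw = begin
    count (isFirst (suc n) Q) (allFin (suc n)) ≡⟨ cong (count (isFirst (suc n) Q)) (allFin-suc n) ⟩
    count (isFirst (suc n) Q) (Fin.zero ∷ map Fin.suc (allFin n)) ≡⟨ count-∷ (isFirst (suc n) Q) Fin.zero _ ⟩
    𝟙 (isFirst (suc n) Q Fin.zero) N.+ count (isFirst (suc n) Q) (map Fin.suc (allFin n)) ≡⟨ cong₂ N._+_ (cong 𝟙 (isFirst-zero n Q)) (trans (count-map _ Fin.suc (allFin n)) (count-cong _ _ (allFin n) (isFirst-suc n Q))) ⟩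
    𝟙 (Q Fin.zero) N.+ count (λ d → Q (Fin.suc d) ∧ not (Q Fin.zero ∨ any (λ b → ⌊ b Fin.<? d ⌋ ∧ Q (Fin.suc b)) (allFin n))) (allFin n) ≡⟨ fin (Q Fin.zero) refl w tw ⟩
    1 ∎
  where
  open ≡-Reasoning
  fin : ∀ q → Q Fin.zero ≡ q → (w : Fin (suc n)) → T (Q w) → 𝟙 q N.+ count (λ d → Q (Fin.suc d) ∧ not (q ∨ any (λ b → ⌊ b Fin.<? d ⌋ ∧ Q (Fin.suc b)) (allFin n))) (allFin n) ≡ 1
  fin true e _ _ = cong suc (count-none _ (allFin n) (λ d → ∧-zeroʳ _))
  fin false e Fin.zero tw = ⊥-elim (subst T e tw)
  fin false e (Fin.suc w') tw = count-isFirst n (Q ∘ Fin.suc) w' tw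

-- The number of classes with property P that occur in L but not in S, counted
-- by scanning L.
countNew : ∀ {n} → (Fin n → Fin n → Bool) → (Fin n → Bool) → List (Fin n) → List (Fin n) → ℕ
countNew c P S [] = 0
countNew c P S (a ∷ L) = 𝟙 (P a ∧ not (any (c a) S)) N.+ countNew c P (a ∷ S) L

countNew-map : ∀ {n m} (c : Fin n → Fin n → Bool) (P : Fin n → Bool) (c' : Fin m → Fin m → Bool) (P' : Fin m → Bool) (ψ : Fin n → Fin m) →
  (∀ a b → c a b ≡ c' (ψ a) (ψ b)) → (∀ a → P a ≡ P' (ψ a)) → ∀ S L → countNew c P S L ≡ countNew c' P' (map ψ S) (map ψ L)
countNew-map c P c' P' ψ ec eP S [] = refl
countNew-map c P c' P' ψ ec eP S (a ∷ L) = cong₂ N._+_ (cong 𝟙 (cong₂ _∧_ (eP a) (cong not (trans (any-cong _ _ S (λ b → ec a b)) (sym (any-map (c' (ψ a)) ψ S)))))) (countNew-map c P c' P' ψ ec eP (a ∷ S) L)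

record BoolEquivalence (n : ℕ) : Set where
  field
    c : Fin n → Fin n → Bool
    crefl : ∀ a → T (c a a)
    csym : ∀ {a b} → T (c a b) → T (c b a)
    ctrans : ∀ {a b d} → T (c a b) → T (c b d) → T (c a d)

-- isRoot F in Defs is isLeast (conn F).
isLeast : ∀ {n} → (Fin n → Fin n → Bool) → Fin n → Bool
isLeast {n} c a = not (any (λ b → ⌊ b Fin.<? a ⌋ ∧ c a b) (allFin n))

module LeastRepresentatives {n : ℕ} (E : BoolEquivalence n) where
  open BoolEquivalence E

  isRep : Fin n → Bool
  isRep = isLeast c

  c-shift : ∀ {d a} → T (c d a) → ∀ x → c d x ≡ c a x
  c-shift t x = T-ext (λ s → ctrans (csym t) s) (λ s → ctrans t s)

  count-reps-of-class : ∀ a → count (λ d → isRep d ∧ c d a) (allFin n) ≡ 1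
  count-reps-of-class a = trans (count-cong _ _ (allFin n) h) (count-isFirst n (λ b → c b a) a (crefl a))
    where
    h : ∀ d → (isRep d ∧ c d a) ≡ isFirst n (λ b → c b a) d
    h d with c d a in eq
    ... | false = ∧-zeroʳ _
    ... | true = trans (∧-identityʳ _) (cong not (any-cong _ _ (allFin n) λ b → cong (⌊ b Fin.<? d ⌋ ∧_) (T-ext (λ s → ctrans (csym s) (subst T (sym eq) tt)) (λ s → ctrans (subst T (sym eq) tt) (csym s)))))

  module _ (P : Fin n → Bool) (Pinv : ∀ {a b} → T (c a b) → P a ≡ P b) where

    countNew≡count : ∀ S L → countNew c P S L ≡ count (λ d → isRep d ∧ (P d ∧ (any (c d) L ∧ not (any (c d) S)))) (allFin n)
    countNew≡count S [] = sym (count-none _ (allFin n) (λ d → h (isRep d) (P d) (not (any (c d) S))))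
      where
      h : ∀ x y z → (x ∧ (y ∧ (false ∧ z))) ≡ false
      h true true z = refl
      h true false z = refl
      h false y z = refl
    countNew≡count S (a ∷ L) = begin
        𝟙 K N.+ countNew c P (a ∷ S) L
          ≡⟨ cong (𝟙 K N.+_) (countNew≡count (a ∷ S) L) ⟩
        𝟙 K N.+ count (λ d → isRep d ∧ (P d ∧ (any (c d) L ∧ not (c d a ∨ any (c d) S)))) (allFin n)
          ≡⟨ cong₂ N._+_ (sym count-class-of-a) (count-cong _ _ (allFin n) outside-class-of-a) ⟩
        count (λ d → H d ∧ c d a) (allFin n) N.+ count (λ d → H d ∧ not (c d a)) (allFin n)
          ≡⟨ count-split H (λ d → c d a) (allFin n) ⟨
        count H (allFin n) ∎
      where
      open ≡-Reasoning
      K : Bool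
      K = P a ∧ not (any (c a) S)
      H : Fin n → Bool
      H = λ d → isRep d ∧ (P d ∧ ((c d a ∨ any (c d) L) ∧ not (any (c d) S)))
      in-class-of-a : ∀ d → (H d ∧ c d a) ≡ (K ∧ (isRep d ∧ c d a))
      in-class-of-a d with c d a in eq
      ... | false = trans (∧-zeroʳ _) (sym (trans (cong (K ∧_) (∧-zeroʳ _)) (∧-zeroʳ _)))
      ... | true rewrite Pinv {d} {a} (subst T (sym eq) tt) | any-cong (c d) (c a) S (c-shift {d} {a} (subst (λ b → T b) (sym eq) tt)) = lem (isRep d) (P a) (any (c a) S) (any (c d) L)
        where
        lem : ∀ x y z w → ((x ∧ (y ∧ ((true ∨ w) ∧ not z))) ∧ true) ≡ ((y ∧ not z) ∧ (x ∧ true))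
        lem true true true w = refl
        lem true true false w = refl
        lem true false z w = refl
        lem false true true w = refl
        lem false true false w = refl
        lem false false z w = refl
      count-class-of-a : count (λ d → H d ∧ c d a) (allFin n) ≡ 𝟙 K
      count-class-of-a = begin
        count (λ d → H d ∧ c d a) (allFin n)               ≡⟨ count-cong _ _ (allFin n) in-class-of-a ⟩
        count (λ d → K ∧ (isRep d ∧ c d a)) (allFin n)     ≡⟨ count-const∧ K _ (allFin n) ⟩
        𝟙 K N.* count (λ d → isRep d ∧ c d a) (allFin n)   ≡⟨ cong (𝟙 K N.*_) (count-reps-of-class a) ⟩
        𝟙 K N.* 1                                          ≡⟨ NP.*-identityʳ _ ⟩
        𝟙 K                                                ∎
      outside-class-of-a : ∀ d → (isRep d ∧ (P d ∧ (any (c d) L ∧ not (c d a ∨ any (c d) S)))) ≡ (H d ∧ not (c d a))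
      outside-class-of-a d = lem (isRep d) (P d) (any (c d) L) (c d a) (any (c d) S)
        where
        lem : ∀ x y l e s → (x ∧ (y ∧ (l ∧ not (e ∨ s)))) ≡ ((x ∧ (y ∧ ((e ∨ l) ∧ not s))) ∧ not e)
        lem false y l e s = refl
        lem true false l e s = refl
        lem true true true true true = refl
        lem true true true true false = refl
        lem true true false true true = refl
        lem true true false true false = refl
        lem true true true false true = refl
        lem true true true false false = refl
        lem true true false false true = refl
        lem true true false false false = refl

    count-reps≡countNew : count (λ d → isRep d ∧ P d) (allFin n) ≡ countNew c P [] (allFin n)
    count-reps≡countNew = sym (trans (countNew≡count [] (allFin n)) (count-cong _ _ (allFin n) simplify))
      where
      simplify : ∀ d → (isRep d ∧ (P d ∧ (any (c d) (allFin n) ∧ true))) ≡ (isRep d ∧ P d)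
      simplify d = begin
        isRep d ∧ (P d ∧ (any (c d) (allFin n) ∧ true))  ≡⟨ cong (λ t → isRep d ∧ (P d ∧ t)) (∧-identityʳ _) ⟩
        isRep d ∧ (P d ∧ any (c d) (allFin n))           ≡⟨ cong (λ t → isRep d ∧ (P d ∧ t)) (T⇒≡true (any-intro (c d) (allFin n) (∈-allFin d) (crefl d))) ⟩
        isRep d ∧ (P d ∧ true)                           ≡⟨ cong (isRep d ∧_) (∧-identityʳ _) ⟩
        isRep d ∧ P d                                    ∎
        where open ≡-Reasoning

count-reps-transport : ∀ {n m} (E : BoolEquivalence n) (E' : BoolEquivalence m) (P : Fin n → Bool) (P' : Fin m → Bool)
  (Pinv : ∀ {a b} → T (BoolEquivalence.c E a b) → P a ≡ P b) (P'inv : ∀ {a b} → T (BoolEquivalence.c E' a b) → P' a ≡ P' b)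
  (ψ : Fin n → Fin m) → (∀ a b → BoolEquivalence.c E a b ≡ BoolEquivalence.c E' (ψ a) (ψ b)) → (∀ a → P a ≡ P' (ψ a)) →
  count (λ d → isLeast (BoolEquivalence.c E) d ∧ P d) (allFin n)
    ≡ count (λ d → isLeast (BoolEquivalence.c E') d ∧ (P' d ∧ any (BoolEquivalence.c E' d) (map ψ (allFin n)))) (allFin m)
count-reps-transport {n} {m} E E' P P' Pinv P'inv ψ ec eP = begin
    count (λ d → isLeast c d ∧ P d) (allFin n)                   ≡⟨ LeastRepresentatives.count-reps≡countNew E P Pinv ⟩
    countNew c P [] (allFin n)                                   ≡⟨ countNew-map c P c' P' ψ ec eP [] (allFin n) ⟩
    countNew c' P' [] (map ψ (allFin n))                         ≡⟨ LeastRepresentatives.countNew≡count E' P' P'inv [] (map ψ (allFin n)) ⟩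
    count (λ d → isLeast c' d ∧ (P' d ∧ (any (c' d) (map ψ (allFin n)) ∧ true))) (allFin m)
      ≡⟨ count-cong _ _ (allFin m) (λ d → cong (λ t → isLeast c' d ∧ (P' d ∧ t)) (∧-identityʳ _)) ⟩
    count (λ d → isLeast c' d ∧ (P' d ∧ any (c' d) (map ψ (allFin n)))) (allFin m) ∎
  where
  open ≡-Reasoning
  open BoolEquivalence E using (c)
  open BoolEquivalence E' renaming (c to c')

all-filter-intro : (q r : A → Bool) (xs : List A) → (∀ x → T (r x) → T (q x)) → T (all q (filter (λ x → T? (r x)) xs))
all-filter-intro q r [] f = tt
all-filter-intro q r (x ∷ xs) f with r x in eq
... | true = ∧-intro (f x (subst T (sym eq) tt)) (all-filter-intro q r xs f)
... | false = all-filter-intro q r xs f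

all-filter-elim : (q r : A → Bool) (xs : List A) → T (all q (filter (λ x → T? (r x)) xs)) → ∀ x → x ∈ xs → T (r x) → T (q x)
all-filter-elim q r (y ∷ xs) t x m tr with r y in eq
all-filter-elim q r (y ∷ xs) t x (here refl) tr | true = ∧-elimˡ t
all-filter-elim q r (y ∷ xs) t x (there m) tr | true = all-filter-elim q r xs (∧-elimʳ {q y} t) x m tr
all-filter-elim q r (y ∷ xs) t x (here refl) tr | false = ⊥-elim (subst T eq tr)
all-filter-elim q r (y ∷ xs) t x (there m) tr | false = all-filter-elim q r xs t x m tr

any-filter-intro : (q r : A → Bool) (xs : List A) → (x : A) → x ∈ xs → T (r x) → T (q x) → T (any q (filter (λ x → T? (r x)) xs))
any-filter-intro q r (y ∷ xs) x m tr tq with r y in eq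
any-filter-intro q r (y ∷ xs) x (here refl) tr tq | true = ∨-introˡ _ tq
any-filter-intro q r (y ∷ xs) x (there m) tr tq | true = ∨-introʳ (q y) (any-filter-intro q r xs x m tr tq)
any-filter-intro q r (y ∷ xs) x (here refl) tr tq | false = ⊥-elim (subst T eq tr)
any-filter-intro q r (y ∷ xs) x (there m) tr tq | false = any-filter-intro q r xs x m tr tq

any-filter-elim : (q r : A → Bool) (xs : List A) → T (any q (filter (λ x → T? (r x)) xs)) → Σ A λ x → T (r x) × T (q x)
any-filter-elim q r (y ∷ xs) t with r y in eq
... | false = any-filter-elim q r xs t
... | true with ∨-elim {q y} t
... | inj₁ t1 = y , subst T (sym eq) tt , t1
... | inj₂ t2 = any-filter-elim q r xs t2

module Components {n : ℕ} (F : List (Arc n)) where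
  open Connectivity F

  conn-equivalence : BoolEquivalence n
  conn-equivalence = record { c = conn F ; crefl = conn-refl ; csym = conn-sym ; ctrans = conn-trans }

  deg1 : Fin n → Bool
  deg1 b = ⌊ indeg F b N.≟ 1 ⌋ ∧ ⌊ outdeg F b N.≟ 1 ⌋

  cyc-intro : ∀ a → (∀ b → T (conn F a b) → T (deg1 b)) → T (isCycleComp F a)
  cyc-intro a f = all-filter-intro deg1 (conn F a) (allFin n) f

  cyc-elim : ∀ a → T (isCycleComp F a) → ∀ b → T (conn F a b) → T (deg1 b)
  cyc-elim a t b tc = all-filter-elim deg1 (conn F a) (allFin n) t b (∈-allFin b) tc

  out1 in0 : Fin n → Bool
  out1 b = ⌊ outdeg F b N.≟ 1 ⌋
  in0 b = ⌊ indeg F b N.≟ 0 ⌋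

  path-intro : ∀ a b b' → T (conn F a b) → T (out1 b) → T (conn F a b') → T (in0 b') → T (isPathComp F a)
  path-intro a b b' c1 t1 c2 t2 = ∧-intro (any-filter-intro out1 (conn F a) (allFin n) b (∈-allFin b) c1 t1) (any-filter-intro in0 (conn F a) (allFin n) b' (∈-allFin b') c2 t2)

  path-elim1 : ∀ a → T (isPathComp F a) → Σ (Fin n) λ b → T (conn F a b) × T (out1 b)
  path-elim1 a t = any-filter-elim out1 (conn F a) (allFin n) (∧-elimˡ t)

  path-elim2 : ∀ a → T (isPathComp F a) → Σ (Fin n) λ b → T (conn F a b) × T (in0 b)
  path-elim2 a t = any-filter-elim in0 (conn F a) (allFin n) (∧-elimʳ {any out1 (filter (λ x → T? (conn F a x)) (allFin n))} t)

  cyc-inv : ∀ {a b} → T (conn F a b) → isCycleComp F a ≡ isCycleComp F b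
  cyc-inv {a} {b} t = T-ext (λ s → cyc-intro b λ d td → cyc-elim a s d (conn-trans t td)) (λ s → cyc-intro a λ d td → cyc-elim b s d (conn-trans (conn-sym t) td))

  path-inv1 : ∀ {a b} → T (conn F a b) → T (isPathComp F a) → T (isPathComp F b)
  path-inv1 {a} {b} t s with path-elim1 a s | path-elim2 a s
  ... | d , c1 , t1 | d' , c2 , t2 = path-intro b d d' (conn-trans (conn-sym t) c1) t1 (conn-trans (conn-sym t) c2) t2

  path-inv : ∀ {a b} → T (conn F a b) → isPathComp F a ≡ isPathComp F b
  path-inv t = T-ext (path-inv1 t) (path-inv1 (conn-sym t))

  adm-intro : (∀ b → outdeg F b N.≤ 1 × indeg F b N.≤ 1) → T (admissible F)
  adm-intro f = all-intro _ (allFin n) λ b _ → ∧-intro {⌊ outdeg F b N.≤? 1 ⌋} {⌊ indeg F b N.≤? 1 ⌋} (fromWitness {a? = outdeg F b N.≤? 1} (proj₁ (f b))) (fromWitness {a? = indeg F b N.≤? 1} (proj₂ (f b)))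

  adm-elim : T (admissible F) → ∀ b → outdeg F b N.≤ 1 × indeg F b N.≤ 1
  adm-elim t b = let s = all-elim _ (allFin n) t b (∈-allFin b) in
    toWitness {a? = outdeg F b N.≤? 1} (∧-elimˡ s) , toWitness {a? = indeg F b N.≤? 1} (∧-elimʳ {⌊ outdeg F b N.≤? 1 ⌋} s)

deg1⇒indeg : ∀ {n} (H : List (Arc n)) b → T (Components.deg1 H b) → indeg H b ≡ 1
deg1⇒indeg H b t = ≟⇒≡ (∧-elimˡ t)

deg1⇒outdeg : ∀ {n} (H : List (Arc n)) b → T (Components.deg1 H b) → outdeg H b ≡ 1
deg1⇒outdeg H b t = ≟⇒≡ (∧-elimʳ {⌊ indeg H b N.≟ 1 ⌋} t)

deg1-intro : ∀ {n} (H : List (Arc n)) b → indeg H b ≡ 1 → outdeg H b ≡ 1 → T (Components.deg1 H b)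
deg1-intro H b i o = ∧-intro (≡⇒≟ i) (≡⇒≟ o)

weight : ∀ {n} → ℚ → ℚ → ℚ → List (Arc n) → ℚ
weight X Y Z F = if admissible F then pow X (length F) * pow Y (kc F) * pow Z (kp F) else 0ℚ

σπ′ : (n : ℕ) → List (Arc n) → ℚ → ℚ → ℚ → ℚ
σπ′ n es X Y Z = sumBy (weight X Y Z) (subLists es)

weight-inadmissible : ∀ {n} X Y Z (H : List (Arc n)) → admissible H ≡ false → weight X Y Z H ≡ 0ℚ
weight-inadmissible X Y Z H e rewrite e = refl

weight-admissible : ∀ {n} X Y Z (H : List (Arc n)) → admissible H ≡ true →
  weight X Y Z H ≡ pow X (length H) * pow Y (kc H) * pow Z (kp H)
weight-admissible X Y Z H e rewrite e = refl

pow-+1ʳ : ∀ Z p → pow Z (p N.+ 1) ≡ pow Z p * Z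
pow-+1ʳ Z zero = trans (QP.*-identityʳ Z) (sym (QP.*-identityˡ Z))
pow-+1ʳ Z (suc p) = trans (cong (Z *_) (pow-+1ʳ Z p)) (sym (QP.*-assoc Z (pow Z p) Z))

-1+1 : ∀ Z → (Z - 1ℚ) + 1ℚ ≡ Z
-1+1 Z = trans (QP.+-assoc Z (Q.- 1ℚ) 1ℚ) (trans (cong (Z +_) (QP.+-inverseˡ 1ℚ)) (QP.+-identityʳ Z))

weight-factor-arc : ∀ X Y Z l k p (b : Bool) → pow X (suc l) * pow Y k * pow Z (p N.+ 𝟙 b) ≡ X * (pow X l * pow Y k * pow Z p) + (X * (Z - 1ℚ)) * onlyIf b (pow X l * pow Y k * pow Z p)
weight-factor-arc X Y Z l k p false rewrite NP.+-identityʳ p =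
  solve 5 (λ X A B C D → (X :* A) :* B :* C := X :* (A :* B :* C) :+ D :* con 0ℚ) refl X (pow X l) (pow Y k) (pow Z p) (X * (Z - 1ℚ))
weight-factor-arc X Y Z l k p true = begin
    (X * pow X l) * pow Y k * pow Z (p N.+ 1) ≡⟨ cong ((X * pow X l) * pow Y k *_) (pow-+1ʳ Z p) ⟩
    (X * pow X l) * pow Y k * (pow Z p * Z) ≡⟨ cong (λ t → (X * pow X l) * pow Y k * (pow Z p * t)) (sym (-1+1 Z)) ⟩
    (X * pow X l) * pow Y k * (pow Z p * ((Z - 1ℚ) + 1ℚ))
      ≡⟨ solve 5 (λ X A B C D → (X :* A) :* B :* (C :* (D :+ con 1ℚ)) := X :* (A :* B :* C) :+ (X :* D) :* (A :* B :* C)) refl X (pow X l) (pow Y k) (pow Z p) (Z - 1ℚ) ⟩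
    X * (pow X l * pow Y k * pow Z p) + (X * (Z - 1ℚ)) * (pow X l * pow Y k * pow Z p) ∎
  where open ≡-Reasoning

weight-factor-loop : ∀ X Y Z l k p → pow X (suc l) * pow Y (suc k) * pow Z p ≡ X * Y * (pow X l * pow Y k * pow Z p)
weight-factor-loop X Y Z l k p = solve 5 (λ X Y A B C → (X :* A) :* (Y :* B) :* C := X :* Y :* (A :* B :* C)) refl X Y (pow X l) (pow Y k) (pow Z p)

weight-cong : ∀ {n m} X Y Z (F : List (Arc n)) (G : List (Arc m)) → admissible F ≡ admissible G →
  length F ≡ length G → kc F ≡ kc G → kp F ≡ kp G → weight X Y Z F ≡ weight X Y Z G
weight-cong X Y Z F G adm len kc≡ kp≡ =
  cong₂ (λ b w → if b then w else 0ℚ) adm (cong₃ (λ l k k′ → pow X l * pow Y k * pow Z k′) len kc≡ kp≡)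

weight-loop-factor : ∀ {n m} X Y Z (F₀ : List (Arc n)) (G : List (Arc m)) → admissible F₀ ≡ admissible G →
  length F₀ ≡ suc (length G) → kc F₀ ≡ suc (kc G) → kp F₀ ≡ kp G → weight X Y Z F₀ ≡ X * Y * weight X Y Z G
weight-loop-factor X Y Z F₀ G adm len kc≡ kp≡ = by-admissibility (admissible G) refl
  where
  open ≡-Reasoning
  by-admissibility : ∀ a → admissible G ≡ a → weight X Y Z F₀ ≡ X * Y * weight X Y Z G
  by-admissibility false e = begin
    weight X Y Z F₀         ≡⟨ weight-inadmissible X Y Z F₀ (trans adm e) ⟩
    0ℚ                      ≡⟨ QP.*-zeroʳ (X * Y) ⟨
    X * Y * 0ℚ              ≡⟨ cong (X * Y *_) (weight-inadmissible X Y Z G e) ⟨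
    X * Y * weight X Y Z G  ∎
  by-admissibility true e = begin
    weight X Y Z F₀
      ≡⟨ weight-admissible X Y Z F₀ (trans adm e) ⟩
    pow X (length F₀) * pow Y (kc F₀) * pow Z (kp F₀)
      ≡⟨ cong₃ (λ l k k′ → pow X l * pow Y k * pow Z k′) len kc≡ kp≡ ⟩
    pow X (suc (length G)) * pow Y (suc (kc G)) * pow Z (kp G)
      ≡⟨ weight-factor-loop X Y Z (length G) (kc G) (kp G) ⟩
    X * Y * (pow X (length G) * pow Y (kc G) * pow Z (kp G))
      ≡⟨ cong (X * Y *_) (weight-admissible X Y Z G e) ⟨
    X * Y * weight X Y Z G ∎

-- The path count is only controlled for admissible G; otherwise both sides vanish.
weight-arc-factor : ∀ {n m} X Y Z (F₀ : List (Arc n)) (G : List (Arc m)) (b : Bool) →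
  admissible F₀ ≡ admissible G → length F₀ ≡ suc (length G) → kc F₀ ≡ kc G →
  (T (admissible G) → kp F₀ ≡ kp G N.+ 𝟙 b) →
  weight X Y Z F₀ ≡ X * weight X Y Z G + X * (Z - 1ℚ) * onlyIf b (weight X Y Z G)
weight-arc-factor X Y Z F₀ G b adm len kc≡ kp≡ = by-admissibility (admissible G) refl
  where
  open ≡-Reasoning
  by-admissibility : ∀ a → admissible G ≡ a → weight X Y Z F₀ ≡ X * weight X Y Z G + X * (Z - 1ℚ) * onlyIf b (weight X Y Z G)
  by-admissibility false e = begin
    weight X Y Z F₀                ≡⟨ weight-inadmissible X Y Z F₀ (trans adm e) ⟩
    0ℚ                             ≡⟨ solve 2 (λ X K → X :* con 0ℚ :+ K :* con 0ℚ := con 0ℚ) refl X (X * (Z - 1ℚ)) ⟨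
    X * 0ℚ + X * (Z - 1ℚ) * 0ℚ     ≡⟨ cong₂ (λ s t → X * s + X * (Z - 1ℚ) * t) G≡0 (trans (cong (onlyIf b) G≡0) (onlyIf-zero b)) ⟨
    X * weight X Y Z G + X * (Z - 1ℚ) * onlyIf b (weight X Y Z G) ∎
    where G≡0 = weight-inadmissible X Y Z G e
  by-admissibility true e = begin
    weight X Y Z F₀
      ≡⟨ weight-admissible X Y Z F₀ (trans adm e) ⟩
    pow X (length F₀) * pow Y (kc F₀) * pow Z (kp F₀)
      ≡⟨ cong₃ (λ l k k′ → pow X l * pow Y k * pow Z k′) len kc≡ (kp≡ (subst T (sym e) _)) ⟩
    pow X (suc (length G)) * pow Y (kc G) * pow Z (kp G N.+ 𝟙 b)
      ≡⟨ weight-factor-arc X Y Z (length G) (kc G) (kp G) b ⟩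
    X * W + X * (Z - 1ℚ) * onlyIf b W
      ≡⟨ cong₂ (λ s t → X * s + X * (Z - 1ℚ) * onlyIf b t) G≡W G≡W ⟨
    X * weight X Y Z G + X * (Z - 1ℚ) * onlyIf b (weight X Y Z G) ∎
    where
    W = pow X (length G) * pow Y (kc G) * pow Z (kp G)
    G≡W = weight-admissible X Y Z G e

reindex : ∀ {m} (w a : Fin (suc m)) → a ≢ w → Fin m
reindex w a p = punchOut {i = w} {j = a} (≢-sym p)

punchIn-reindex : ∀ {m} (w a : Fin (suc m)) (p : a ≢ w) → punchIn w (reindex w a p) ≡ a
punchIn-reindex w a p = FP.punchIn-punchOut (≢-sym p)

reindex-punchIn : ∀ {m} (w : Fin (suc m)) (c : Fin m) (p : punchIn w c ≢ w) → reindex w (punchIn w c) p ≡ c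
reindex-punchIn w c p = trans (FP.punchOut-cong w refl) (FP.punchOut-punchIn w)

reindex-== : ∀ {m} (w a : Fin (suc m)) (p : a ≢ w) (c : Fin m) → (reindex w a p == c) ≡ (a == punchIn w c)
reindex-== w a p c = T-ext (λ t → ≡⇒== (trans (sym (punchIn-reindex w a p)) (cong (punchIn w) (==⇒≡ t))))
                    (λ t → ≡⇒== (trans (FP.punchOut-cong w (==⇒≡ t)) (FP.punchOut-punchIn w)))

delVertex-keep : ∀ {m} (w a b : Fin (suc m)) (L : List (Arc (suc m))) (aw : a ≢ w) (bw : b ≢ w) →
  delVertex w ((a , b) ∷ L) ≡ (reindex w a aw , reindex w b bw) ∷ delVertex w L
delVertex-keep w a b L aw bw with a FP.≟ w | b FP.≟ w
... | yes e | _ = ⊥-elim (aw e)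
... | no _ | yes e = ⊥-elim (bw e)
... | no p | no q = cong₂ (λ x y → (x , y) ∷ delVertex w L) (FP.punchOut-cong w refl) (FP.punchOut-cong w refl)

delVertex-drop : ∀ {m} (w a b : Fin (suc m)) (L : List (Arc (suc m))) → (a ≡ w ⊎ b ≡ w) → delVertex w ((a , b) ∷ L) ≡ delVertex w L
delVertex-drop w a b L h with a FP.≟ w | b FP.≟ w
... | yes _ | _ = refl
... | no _ | yes _ = refl
... | no p | no q with h
... | inj₁ e = ⊥-elim (p e)
... | inj₂ e = ⊥-elim (q e)

Avoid : ∀ {m} → Fin m → Arc m → Set
Avoid w e = proj₁ e ≢ w × proj₂ e ≢ w

avoidsArc : ∀ {m} → Fin m → Arc m → Bool
avoidsArc w e = not (proj₁ e == w) ∧ not (proj₂ e == w)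

avoids : ∀ {m} → Fin m → List (Arc m) → Bool
avoids w = all (avoidsArc w)

avoids-intro : ∀ {m} (w : Fin m) F → All (Avoid w) F → T (avoids w F)
avoids-intro w [] _ = tt
avoids-intro w ((a , b) ∷ F) ((aw , bw) ∷ av) = ∧-intro (∧-intro (not-intro (λ t → aw (==⇒≡ t))) (not-intro (λ t → bw (==⇒≡ t)))) (avoids-intro w F av)

avoids-elim : ∀ {m} (w : Fin m) F → T (avoids w F) → All (Avoid w) F
avoids-elim w [] _ = []
avoids-elim w ((a , b) ∷ F) t = ((λ e → not-elim (∧-elimˡ (∧-elimˡ t)) (≡⇒== e)) , (λ e → not-elim (∧-elimʳ {not (a == w)} (∧-elimˡ t)) (≡⇒== e))) ∷ avoids-elim w F (∧-elimʳ {not (a == w) ∧ not (b == w)} t)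

module _ {m : ℕ} (w : Fin (suc m)) where

  outdeg-delVertex : ∀ F → All (Avoid w) F → ∀ c → outdeg (delVertex w F) c ≡ outdeg F (punchIn w c)
  outdeg-delVertex [] _ c = refl
  outdeg-delVertex ((a , b) ∷ F) ((aw , bw) ∷ av) c rewrite delVertex-keep w a b F aw bw =
    trans (count-∷ _ _ (delVertex w F)) (trans (cong₂ N._+_ (cong 𝟙 (reindex-== w a aw c)) (outdeg-delVertex F av c)) (sym (count-∷ _ (a , b) F)))

  indeg-delVertex : ∀ F → All (Avoid w) F → ∀ c → indeg (delVertex w F) c ≡ indeg F (punchIn w c)
  indeg-delVertex [] _ c = refl
  indeg-delVertex ((a , b) ∷ F) ((aw , bw) ∷ av) c rewrite delVertex-keep w a b F aw bw =
    trans (count-∷ _ _ (delVertex w F)) (trans (cong₂ N._+_ (cong 𝟙 (reindex-== w b bw c)) (indeg-delVertex F av c)) (sym (count-∷ _ (a , b) F)))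

  outdeg-avoided : ∀ F → All (Avoid w) F → outdeg F w ≡ 0
  outdeg-avoided [] _ = refl
  outdeg-avoided ((a , b) ∷ F) ((aw , bw) ∷ av) = trans (count-∷ _ (a , b) F) (cong₂ N._+_ (cong 𝟙 (≢⇒==false aw)) (outdeg-avoided F av))

  indeg-avoided : ∀ F → All (Avoid w) F → indeg F w ≡ 0
  indeg-avoided [] _ = refl
  indeg-avoided ((a , b) ∷ F) ((aw , bw) ∷ av) = trans (count-∷ _ (a , b) F) (cong₂ N._+_ (cong 𝟙 (≢⇒==false bw)) (indeg-avoided F av))

  adj-delVertex : ∀ F → All (Avoid w) F → ∀ c d → adj (delVertex w F) c d ≡ adj F (punchIn w c) (punchIn w d)
  adj-delVertex [] _ c d = refl
  adj-delVertex ((a , b) ∷ F) ((aw , bw) ∷ av) c d rewrite delVertex-keep w a b F aw bw =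
    cong₂ _∨_ (cong₂ _∨_ (cong₂ _∧_ (reindex-== w a aw c) (reindex-== w b bw d)) (cong₂ _∧_ (reindex-== w a aw d) (reindex-== w b bw c))) (adj-delVertex F av c d)

  adj-avoidedˡ : ∀ F → All (Avoid w) F → ∀ x → adj F w x ≡ false
  adj-avoidedˡ [] _ x = refl
  adj-avoidedˡ ((a , b) ∷ F) ((aw , bw) ∷ av) x rewrite ≢⇒==false aw | ≢⇒==false bw = trans (cong (_∨ adj F w x) (h (b == x) (a == x))) (adj-avoidedˡ F av x)
    where
    h : ∀ p q → ((false ∧ p) ∨ (q ∧ false)) ≡ false
    h p true = refl
    h p false = refl

  adj-avoidedʳ : ∀ F → All (Avoid w) F → ∀ x → adj F x w ≡ false
  adj-avoidedʳ [] _ x = refl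
  adj-avoidedʳ ((a , b) ∷ F) ((aw , bw) ∷ av) x rewrite ≢⇒==false aw | ≢⇒==false bw = trans (cong (_∨ adj F x w) (h (a == x) (b == x))) (adj-avoidedʳ F av x)
    where
    h : ∀ p q → ((p ∧ false) ∨ (false ∧ q)) ≡ false
    h true q = refl
    h false q = refl

  length-delVertex-avoided : ∀ F → All (Avoid w) F → length (delVertex w F) ≡ length F
  length-delVertex-avoided [] _ = refl
  length-delVertex-avoided ((a , b) ∷ F) ((aw , bw) ∷ av) rewrite delVertex-keep w a b F aw bw = cong suc (length-delVertex-avoided F av)

punchIn-view : ∀ {m} (w b : Fin (suc m)) → b ≡ w ⊎ Σ (Fin m) λ c → b ≡ punchIn w c
punchIn-view w b with b FP.≟ w
... | yes e = inj₁ e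
... | no p = inj₂ (reindex w b p , sym (punchIn-reindex w b p))

module DeleteIsolated {m : ℕ} (w : Fin (suc m)) (F : List (Arc (suc m))) (av : All (Avoid w) F) where
  G : List (Arc m)
  G = delVertex w F
  ψ : Fin m → Fin (suc m)
  ψ = punchIn w
  module RF = Connectivity F
  module RG = Connectivity G
  module SF = Components F
  module SG = Components G

  within-isolated : ∀ k {x} → RF.Within k x w → x ≡ w
  within-isolated zero (RF.within t) = ==⇒≡ t
  within-isolated (suc k) r with RF.within-cases r
  ... | inj₁ r' = within-isolated k r'
  ... | inj₂ (c , r' , t) = ⊥-elim (subst T (adj-avoidedʳ w F av c) t)

  conn-isolated : ∀ {x} → T (conn F x w) → x ≡ w
  conn-isolated t = within-isolated (suc m) (RF.within t)

  within-delete : ∀ k {a b} → RF.Within k (ψ a) (ψ b) → RG.Within k a b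
  within-delete zero (RF.within t) = RG.within (≡⇒== (FP.punchIn-injective w _ _ (==⇒≡ t)))
  within-delete (suc k) r with RF.within-cases r
  ... | inj₁ r' = RG.within-suc (within-delete k r')
  ... | inj₂ (c , r' , t) with punchIn-view w c
  ... | inj₁ e = ⊥-elim (subst T (adj-avoidedˡ w F av _) (subst (λ x → T (adj F x _)) e t))
  ... | inj₂ (c' , e) = RG.within-step (within-delete k (subst (RF.Within k _) e r')) (subst T (sym (adj-delVertex w F av c' _)) (subst (λ x → T (adj F x _)) e t))

  within-undelete : ∀ k {a b} → RG.Within k a b → RF.Within k (ψ a) (ψ b)
  within-undelete zero (RG.within t) = RF.within (≡⇒== (cong ψ (==⇒≡ t)))
  within-undelete (suc k) r with RG.within-cases r
  ... | inj₁ r' = RF.within-suc (within-undelete k r')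
  ... | inj₂ (c , r' , t) = RF.within-step (within-undelete k r') (subst T (adj-delVertex w F av c _) t)

  conn-eq : ∀ a b → conn F (ψ a) (ψ b) ≡ conn G a b
  conn-eq a b = T-ext (λ t → RG.within⇒conn (suc m) (within-delete (suc m) (RF.within t))) (λ t → RF.within⇒conn m (within-undelete m (RG.within t)))

  out-eq : ∀ c → outdeg F (ψ c) ≡ outdeg G c
  out-eq c = sym (outdeg-delVertex w F av c)
  in-eq : ∀ c → indeg F (ψ c) ≡ indeg G c
  in-eq c = sym (indeg-delVertex w F av c)

  deg1-eq : ∀ c → SF.deg1 (ψ c) ≡ SG.deg1 c
  deg1-eq c rewrite out-eq c | in-eq c = refl

  cyc-eq : ∀ a → isCycleComp F (ψ a) ≡ isCycleComp G a
  cyc-eq a = T-ext (λ t → SG.cyc-intro a λ b tb → subst T (deg1-eq b) (SF.cyc-elim (ψ a) t (ψ b) (subst T (sym (conn-eq a b)) tb)))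
    (λ t → SF.cyc-intro (ψ a) λ b tb → h t b tb (punchIn-view w b))
    where
    h : T (isCycleComp G a) → ∀ b → T (conn F (ψ a) b) → (b ≡ w ⊎ Σ (Fin m) λ c → b ≡ ψ c) → T (SF.deg1 b)
    h t b tb (inj₁ e) = ⊥-elim (FP.punchInᵢ≢i w a (conn-isolated (subst (λ x → T (conn F (ψ a) x)) e tb)))
    h t b tb (inj₂ (c , e)) rewrite e = subst T (sym (deg1-eq c)) (SG.cyc-elim a t c (subst T (conn-eq a c) tb))

  cyc-isolated : isCycleComp F w ≡ false
  cyc-isolated = ¬T⇒≡false λ t → subst T (cong (λ k → ⌊ k N.≟ 1 ⌋ ∧ ⌊ outdeg F w N.≟ 1 ⌋) (indeg-avoided w F av)) (SF.cyc-elim w t w (Connectivity.conn-refl F w))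

  path-eq : ∀ a → isPathComp F (ψ a) ≡ isPathComp G a
  path-eq a = T-ext fw bw
    where
    back : ∀ b → T (conn F (ψ a) b) → Σ (Fin m) λ c → b ≡ ψ c
    back b tb with punchIn-view w b
    ... | inj₁ e = ⊥-elim (FP.punchInᵢ≢i w a (conn-isolated (subst (λ x → T (conn F (ψ a) x)) e tb)))
    ... | inj₂ p = p
    fw : T (isPathComp F (ψ a)) → T (isPathComp G a)
    fw t with SF.path-elim1 (ψ a) t | SF.path-elim2 (ψ a) t
    ... | b , cb , ob | b' , cb' , ib' with back b cb | back b' cb'
    ... | c , refl | c' , refl = SG.path-intro a c c' (subst T (conn-eq a c) cb) (subst (λ k → T ⌊ k N.≟ 1 ⌋) (out-eq c) ob) (subst T (conn-eq a c') cb') (subst (λ k → T ⌊ k N.≟ 0 ⌋) (in-eq c') ib')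
    bw : T (isPathComp G a) → T (isPathComp F (ψ a))
    bw t with SG.path-elim1 a t | SG.path-elim2 a t
    ... | c , cb , ob | c' , cb' , ib' = SF.path-intro (ψ a) (ψ c) (ψ c') (subst T (sym (conn-eq a c)) cb) (subst (λ k → T ⌊ k N.≟ 1 ⌋) (sym (out-eq c)) ob) (subst T (sym (conn-eq a c')) cb') (subst (λ k → T ⌊ k N.≟ 0 ⌋) (sym (in-eq c')) ib')

  path-isolated : isPathComp F w ≡ false
  path-isolated = ¬T⇒≡false λ t → h (SF.path-elim1 w t)
    where
    h : (Σ (Fin (suc m)) λ b → T (conn F w b) × T (SF.out1 b)) → ⊥
    h (b , cb , ob) with conn-isolated (Connectivity.conn-sym F cb)
    ... | refl = subst (λ k → T ⌊ k N.≟ 1 ⌋) (outdeg-avoided w F av) ob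

  reaches-image : ∀ d → d ≢ w → any (conn F d) (map ψ (allFin m)) ≡ true
  reaches-image d dw = T⇒≡true (any-intro (conn F d) (map ψ (allFin m)) (∈-map⁺ ψ (∈-allFin (reindex w d dw))) (subst (λ x → T (conn F d x)) (sym (punchIn-reindex w d dw)) (Connectivity.conn-refl F d)))

  count-reps-delete : (P : ∀ {k} → List (Arc k) → Fin k → Bool) → (∀ {k} (H : List (Arc k)) {a b} → T (conn H a b) → P H a ≡ P H b) →
    (∀ a → P F (ψ a) ≡ P G a) → P F w ≡ false →
    count (λ d → isRoot F d ∧ P F d) (allFin (suc m)) ≡ count (λ d → isRoot G d ∧ P G d) (allFin m)
  count-reps-delete P Pinv eqP Pw = sym (trans (count-reps-transport (SG.conn-equivalence) (SF.conn-equivalence) (P G) (P F) (Pinv G) (Pinv F) ψ (λ a b → sym (conn-eq a b)) (λ a → sym (eqP a)))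
    (count-cong _ _ (allFin (suc m)) h))
    where
    h : ∀ d → (isRoot F d ∧ (P F d ∧ any (conn F d) (map ψ (allFin m)))) ≡ (isRoot F d ∧ P F d)
    h d with d FP.≟ w
    ... | yes refl rewrite Pw = refl
    ... | no dw rewrite reaches-image d dw = cong (isRoot F d ∧_) (∧-identityʳ _)

  kc-eq : kc F ≡ kc G
  kc-eq = count-reps-delete (λ H → isCycleComp H) (λ H → Components.cyc-inv H) cyc-eq cyc-isolated

  kp-eq : kp F ≡ kp G
  kp-eq = count-reps-delete (λ H → isPathComp H) (λ H → Components.path-inv H) path-eq path-isolated

  adm-eq : admissible F ≡ admissible G
  adm-eq = T-ext (λ t → SG.adm-intro λ c → subst (N._≤ 1) (out-eq c) (proj₁ (SF.adm-elim t (ψ c))) , subst (N._≤ 1) (in-eq c) (proj₂ (SF.adm-elim t (ψ c))))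
    (λ t → SF.adm-intro λ b → h t b (punchIn-view w b))
    where
    h : T (admissible G) → ∀ b → (b ≡ w ⊎ Σ (Fin m) λ c → b ≡ ψ c) → outdeg F b N.≤ 1 × indeg F b N.≤ 1
    h t b (inj₁ refl) rewrite outdeg-avoided w F av | indeg-avoided w F av = z≤n , z≤n
    h t b (inj₂ (c , refl)) rewrite out-eq c | in-eq c = SG.adm-elim t c

  weight-eq : ∀ X Y Z → weight X Y Z F ≡ weight X Y Z G
  weight-eq X Y Z = weight-cong X Y Z F G adm-eq (sym (length-delVertex-avoided w F av)) kc-eq kp-eq

module AddLoop {m : ℕ} (u : Fin (suc m)) (F : List (Arc (suc m))) (av : All (Avoid u) F) where
  F0 : List (Arc (suc m))
  F0 = (u , u) ∷ F
  module I = DeleteIsolated u F av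
  module R0 = Connectivity F0
  module RF = Connectivity F
  module S0 = Components F0
  module SF = Components F

  within-drop-loop : ∀ k {a b} → R0.Within k a b → RF.Within k a b
  within-drop-loop zero (R0.within t) = RF.within t
  within-drop-loop (suc k) r with R0.within-cases r
  ... | inj₁ r' = RF.within-suc (within-drop-loop k r')
  ... | inj₂ (c , r' , t) with ∨-elim {(u == c ∧ u == _) ∨ (u == _ ∧ u == c)} t
  ... | inj₂ t' = RF.within-step (within-drop-loop k r') t'
  ... | inj₁ t' with ∨-elim {u == c ∧ u == _} t'
  ... | inj₁ s = RF.within-suc (subst (RF.Within k _) (trans (sym (==⇒≡ (∧-elimˡ s))) (==⇒≡ (∧-elimʳ {u == c} s))) (within-drop-loop k r'))
  ... | inj₂ s = RF.within-suc (subst (RF.Within k _) (trans (sym (==⇒≡ (∧-elimʳ {u == _} s))) (==⇒≡ (∧-elimˡ s))) (within-drop-loop k r'))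

  within-add-loop : ∀ k {a b} → RF.Within k a b → R0.Within k a b
  within-add-loop zero (RF.within t) = R0.within t
  within-add-loop (suc k) r with RF.within-cases r
  ... | inj₁ r' = R0.within-suc (within-add-loop k r')
  ... | inj₂ (c , r' , t) = R0.within-step (within-add-loop k r') (∨-introʳ ((u == c ∧ u == _) ∨ (u == _ ∧ u == c)) t)

  conn-eq : ∀ a b → conn F0 a b ≡ conn F a b
  conn-eq a b = T-ext (λ t → RF.unwithin (within-drop-loop (suc m) (R0.within t))) (λ t → R0.unwithin (within-add-loop (suc m) (RF.within t)))

  root-eq : ∀ d → isRoot F0 d ≡ isRoot F d
  root-eq d = cong not (any-cong _ _ (allFin (suc m)) (λ b → cong (⌊ b Fin.<? d ⌋ ∧_) (conn-eq d b)))

  out0 : ∀ x → outdeg F0 x ≡ 𝟙 (u == x) N.+ outdeg F x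
  out0 x = count-∷ _ (u , u) F
  in0 : ∀ x → indeg F0 x ≡ 𝟙 (u == x) N.+ indeg F x
  in0 x = count-∷ _ (u , u) F

  out-away : ∀ {x} → x ≢ u → outdeg F0 x ≡ outdeg F x
  out-away {x} xu = trans (out0 x) (cong (λ t → 𝟙 t N.+ outdeg F x) (≢⇒==false (xu ∘ sym)))
  in-away : ∀ {x} → x ≢ u → indeg F0 x ≡ indeg F x
  in-away {x} xu = trans (in0 x) (cong (λ t → 𝟙 t N.+ indeg F x) (≢⇒==false (xu ∘ sym)))

  deg1-ne : ∀ x → x ≢ u → S0.deg1 x ≡ SF.deg1 x
  deg1-ne x xu rewrite out-away xu | in-away xu = refl

  ne-of-conn : ∀ {a} → ¬ T (conn F a u) → ∀ {b} → T (conn F a b) → b ≢ u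
  ne-of-conn na cb refl = na cb

  cyc-eq : ∀ a → isCycleComp F0 a ≡ (conn F a u ∨ isCycleComp F a)
  cyc-eq a = T-ext fw bw
    where
    fw : T (isCycleComp F0 a) → T (conn F a u ∨ isCycleComp F a)
    fw t with T? (conn F a u)
    ... | yes c = ∨-introˡ _ c
    ... | no nc = ∨-introʳ (conn F a u) (SF.cyc-intro a λ b cb → subst T (deg1-ne b (ne-of-conn nc cb)) (S0.cyc-elim a t b (subst T (sym (conn-eq a b)) cb)))
    bw : T (conn F a u ∨ isCycleComp F a) → T (isCycleComp F0 a)
    bw t with ∨-elim {conn F a u} t
    ... | inj₁ c with I.conn-isolated c
    ... | refl = S0.cyc-intro u λ b cb → h b (I.conn-isolated (RF.conn-sym (subst T (conn-eq u b) cb)))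
      where
      h : ∀ b → b ≡ u → T (S0.deg1 b)
      h b refl rewrite out0 u | in0 u | ==-refl u | indeg-avoided u F av | outdeg-avoided u F av = tt
    bw t | inj₂ s = S0.cyc-intro a λ b cb → k b (SF.cyc-elim a s b (subst T (conn-eq a b) cb))
      where
      h : ∀ b → b ≡ u → T (SF.deg1 b) → ⊥
      h b refl d rewrite indeg-avoided u F av = d
      k : ∀ b → T (SF.deg1 b) → T (S0.deg1 b)
      k b d1 = subst T (sym (deg1-ne b (λ e → h b e d1))) d1

  kc-eq : kc F0 ≡ suc (kc F)
  kc-eq = begin
      count (λ d → isRoot F0 d ∧ isCycleComp F0 d) (allFin (suc m))
        ≡⟨ count-cong _ _ (allFin (suc m)) (λ d → trans (cong₂ _∧_ (root-eq d) (cyc-eq d)) (∧-distribˡ-∨ (isRoot F d) _ _)) ⟩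
      count (λ d → (isRoot F d ∧ conn F d u) ∨ (isRoot F d ∧ isCycleComp F d)) (allFin (suc m))
        ≡⟨ count-∨ _ _ (allFin (suc m)) disjoint ⟩
      count (λ d → isRoot F d ∧ conn F d u) (allFin (suc m)) N.+ kc F
        ≡⟨ cong (N._+ kc F) (LeastRepresentatives.count-reps-of-class SF.conn-equivalence u) ⟩
      suc (kc F) ∎
    where
    open ≡-Reasoning
    disjoint : ∀ d → T (isRoot F d ∧ conn F d u) → T (isRoot F d ∧ isCycleComp F d) → ⊥
    disjoint d t s with I.conn-isolated (∧-elimʳ {isRoot F d} t)
    ... | refl = subst T I.cyc-isolated (∧-elimʳ {isRoot F u} s)

  path-eq : ∀ a → isPathComp F0 a ≡ isPathComp F a
  path-eq a with T? (conn F a u)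
  ... | yes c with I.conn-isolated c
  ... | refl = trans (¬T⇒≡false h) (sym I.path-isolated)
    where
    h : ¬ T (isPathComp F0 u)
    h t with S0.path-elim2 u t
    ... | b , cb , ib with I.conn-isolated (RF.conn-sym (subst T (conn-eq u b) cb))
    ... | refl rewrite in0 u | ==-refl u = ib
  path-eq a | no nc = T-ext fw bw
    where
    away : ∀ {b} → T (conn F a b) → b ≢ u
    away = ne-of-conn nc
    fw : T (isPathComp F0 a) → T (isPathComp F a)
    fw t with S0.path-elim1 a t | S0.path-elim2 a t
    ... | b , cb , ob | b' , cb' , ib' =
      SF.path-intro a b b' cF (subst (λ k → T ⌊ k N.≟ 1 ⌋) (out-away (away cF)) ob) cF' (subst (λ k → T ⌊ k N.≟ 0 ⌋) (in-away (away cF')) ib')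
      where
      cF = subst T (conn-eq a b) cb
      cF' = subst T (conn-eq a b') cb'
    bw : T (isPathComp F a) → T (isPathComp F0 a)
    bw t with SF.path-elim1 a t | SF.path-elim2 a t
    ... | b , cb , ob | b' , cb' , ib' =
      S0.path-intro a b b' (subst T (sym (conn-eq a b)) cb) (subst (λ k → T ⌊ k N.≟ 1 ⌋) (sym (out-away (away cb))) ob)
                           (subst T (sym (conn-eq a b')) cb') (subst (λ k → T ⌊ k N.≟ 0 ⌋) (sym (in-away (away cb'))) ib')

  kp-eq : kp F0 ≡ kp F
  kp-eq = count-cong _ _ (allFin (suc m)) (λ d → cong₂ _∧_ (root-eq d) (path-eq d))

  adm-eq : admissible F0 ≡ admissible F
  adm-eq = T-ext (λ t → SF.adm-intro λ b → h1 t b (b FP.≟ u)) (λ t → S0.adm-intro λ b → h2 t b (b FP.≟ u))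
    where
    h1 : T (admissible F0) → ∀ b → Dec (b ≡ u) → outdeg F b N.≤ 1 × indeg F b N.≤ 1
    h1 t b (yes refl) rewrite outdeg-avoided u F av | indeg-avoided u F av = z≤n , z≤n
    h1 t b (no bu) rewrite sym (out-away bu) | sym (in-away bu) = S0.adm-elim t b
    h2 : T (admissible F) → ∀ b → Dec (b ≡ u) → outdeg F0 b N.≤ 1 × indeg F0 b N.≤ 1
    h2 t b (yes refl) rewrite out0 u | in0 u | ==-refl u | outdeg-avoided u F av | indeg-avoided u F av = s≤s z≤n , s≤s z≤n
    h2 t b (no bu) rewrite out-away bu | in-away bu = SF.adm-elim t b

  weight-eq : ∀ X Y Z → weight X Y Z F0 ≡ X * Y * weight X Y Z F
  weight-eq X Y Z = weight-loop-factor X Y Z F0 F adm-eq refl kc-eq kp-eq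

adj-here : ∀ {n} (x y : Fin n) b → T (((x == x) ∧ (y == y)) ∨ b)
adj-here x y b rewrite ==-refl x | ==-refl y = tt

Compatible : ∀ {n} → Fin n → Fin n → Arc n → Set
Compatible u v e = proj₁ e ≢ u × proj₂ e ≢ v

compatibleArc : ∀ {n} → Fin n → Fin n → Arc n → Bool
compatibleArc u v e = not (proj₁ e == u) ∧ not (proj₂ e == v)

compatible : ∀ {n} → Fin n → Fin n → List (Arc n) → Bool
compatible u v = all (compatibleArc u v)

mergeArc : ∀ {m} {u v : Fin (suc m)} → u ≢ v → Arc (suc m) → Arc m
mergeArc u≢v e = mergeInto u≢v (proj₁ e) , mergeInto u≢v (proj₂ e)

module Contract {m' : ℕ} {u v : Fin (suc (suc m'))} (u≢v : u ≢ v) (F : List (Arc (suc (suc m')))) (ap : All (Compatible u v) F) where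
  μ : Fin (suc (suc m')) → Fin (suc m')
  μ = mergeInto u≢v
  μ2 : Arc (suc (suc m')) → Arc (suc m')
  μ2 = mergeArc u≢v
  F0 : List (Arc (suc (suc m')))
  F0 = (u , v) ∷ F
  G : List (Arc (suc m'))
  G = map μ2 F
  w : Fin (suc m')
  w = reindex v u u≢v

  μ-v : μ v ≡ w
  μ-v with v FP.≟ v
  ... | yes _ = refl
  ... | no p = ⊥-elim (p refl)

  μ-ne : ∀ x (p : x ≢ v) → μ x ≡ reindex v x p
  μ-ne x p with x FP.≟ v
  ... | yes e = ⊥-elim (p e)
  ... | no q = FP.punchOut-cong v refl

  μ-u : μ u ≡ w
  μ-u = μ-ne u u≢v

  μ-pi : ∀ c → μ (punchIn v c) ≡ c
  μ-pi c = trans (μ-ne _ (FP.punchInᵢ≢i v c)) (reindex-punchIn v c (FP.punchInᵢ≢i v c))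

  μ-fibres : ∀ x y → μ x ≡ μ y → x ≡ y ⊎ ((x ≡ u ⊎ x ≡ v) × (y ≡ u ⊎ y ≡ v))
  μ-fibres x y e = h (x FP.≟ v) (y FP.≟ v)
    where
    h : Dec (x ≡ v) → Dec (y ≡ v) → x ≡ y ⊎ ((x ≡ u ⊎ x ≡ v) × (y ≡ u ⊎ y ≡ v))
    h (yes p) (yes q) = inj₁ (trans p (sym q))
    h (yes p) (no q) = inj₂ (inj₂ p , inj₁ (sym (FP.punchOut-injective (≢-sym u≢v) (≢-sym q) (trans (sym μ-v) (trans (cong μ (sym p)) (trans e (μ-ne y q)))))))
    h (no p) (yes q) = inj₂ (inj₁ (FP.punchOut-injective (≢-sym p) (≢-sym u≢v) (trans (sym (μ-ne x p)) (trans e (trans (cong μ q) μ-v)))) , inj₂ q)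
    h (no p) (no q) = inj₁ (FP.punchOut-injective (≢-sym p) (≢-sym q) (trans (sym (μ-ne x p)) (trans e (μ-ne y q))))

  μ-==-other : ∀ x b → b ≢ u → b ≢ v → (μ x == μ b) ≡ (x == b)
  μ-==-other x b bu bv = T-ext (λ t → ≡⇒== (h (μ-fibres x b (==⇒≡ t)))) (λ t → ≡⇒== (cong μ (==⇒≡ t)))
    where
    h : x ≡ b ⊎ ((x ≡ u ⊎ x ≡ v) × (b ≡ u ⊎ b ≡ v)) → x ≡ b
    h (inj₁ e) = e
    h (inj₂ (_ , inj₁ e)) = ⊥-elim (bu e)
    h (inj₂ (_ , inj₂ e)) = ⊥-elim (bv e)

  μ-==-u : ∀ x → x ≢ v → (μ x == μ u) ≡ (x == u)
  μ-==-u x xv = T-ext (λ t → ≡⇒== (h (μ-fibres x u (==⇒≡ t)))) (λ t → ≡⇒== (cong μ (==⇒≡ t)))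
    where
    h : x ≡ u ⊎ ((x ≡ u ⊎ x ≡ v) × (u ≡ u ⊎ u ≡ v)) → x ≡ u
    h (inj₁ e) = e
    h (inj₂ (inj₁ e , _)) = e
    h (inj₂ (inj₂ e , _)) = ⊥-elim (xv e)

  μ-==-v : ∀ x → x ≢ u → (μ x == μ v) ≡ (x == v)
  μ-==-v x xu = T-ext (λ t → ≡⇒== (h (μ-fibres x v (==⇒≡ t)))) (λ t → ≡⇒== (cong μ (==⇒≡ t)))
    where
    h : x ≡ v ⊎ ((x ≡ u ⊎ x ≡ v) × (v ≡ u ⊎ v ≡ v)) → x ≡ v
    h (inj₁ e) = e
    h (inj₂ (inj₁ e , _)) = ⊥-elim (xu e)
    h (inj₂ (inj₂ e , _)) = e

  outdeg-merged : ∀ c → outdeg G c ≡ count (λ e → μ (proj₁ e) == c) F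
  outdeg-merged c = count-map _ μ2 F
  indeg-merged : ∀ c → indeg G c ≡ count (λ e → μ (proj₂ e) == c) F
  indeg-merged c = count-map _ μ2 F

  outdeg-other : ∀ b → b ≢ u → b ≢ v → outdeg F0 b ≡ outdeg G (μ b)
  outdeg-other b bu bv = trans (count-∷ _ (u , v) F) (trans (cong (N._+ outdeg F b) (cong 𝟙 (≢⇒==false (λ e → bu (sym e)))))
    (sym (trans (outdeg-merged (μ b)) (count-cong _ _ F (λ e → μ-==-other (proj₁ e) b bu bv)))))

  indeg-other : ∀ b → b ≢ u → b ≢ v → indeg F0 b ≡ indeg G (μ b)
  indeg-other b bu bv = trans (count-∷ _ (u , v) F) (trans (cong (N._+ indeg F b) (cong 𝟙 (≢⇒==false (λ e → bv (sym e)))))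
    (sym (trans (indeg-merged (μ b)) (count-cong _ _ F (λ e → μ-==-other (proj₂ e) b bu bv)))))

  out-u : outdeg F0 u ≡ 1
  out-u = trans (count-∷ _ (u , v) F) (cong₂ N._+_ (cong 𝟙 (==-refl u)) (count-all-false _ F (All.map (λ p → ≢⇒==false (proj₁ p)) ap)))

  in-v : indeg F0 v ≡ 1
  in-v = trans (count-∷ _ (u , v) F) (cong₂ N._+_ (cong 𝟙 (==-refl v)) (count-all-false _ F (All.map (λ p → ≢⇒==false (proj₂ p)) ap)))

  in-u : indeg F0 u ≡ indeg G (μ u)
  in-u = trans (count-∷ _ (u , v) F) (trans (cong (N._+ indeg F u) (cong 𝟙 (≢⇒==false (λ e → u≢v (sym e)))))
    (sym (trans (indeg-merged (μ u)) (count-congAll _ _ F ap (λ e p → μ-==-u (proj₂ e) (proj₂ p))))))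

  out-v : outdeg F0 v ≡ outdeg G (μ v)
  out-v = trans (count-∷ _ (u , v) F) (trans (cong (N._+ outdeg F v) (cong 𝟙 (≢⇒==false u≢v)))
    (sym (trans (outdeg-merged (μ v)) (count-congAll _ _ F ap (λ e p → μ-==-v (proj₁ e) (proj₁ p))))))

  Position : Fin (suc (suc m')) → Set
  Position b = b ≡ u ⊎ b ≡ v ⊎ (b ≢ u × b ≢ v)

  trichotomy : ∀ b → Position b
  trichotomy b with b FP.≟ u | b FP.≟ v
  ... | yes e | _ = inj₁ e
  ... | no _ | yes e = inj₂ (inj₁ e)
  ... | no p | no q = inj₂ (inj₂ (p , q))

  module R0 = Connectivity F0
  module RG = Connectivity G
  module S0 = Components F0
  module SG = Components G

  adj-elim : ∀ {n} (H : List (Arc n)) c d → T (adj H c d) → Σ (Arc n) λ e → e ∈ H × ((proj₁ e ≡ c × proj₂ e ≡ d) ⊎ (proj₁ e ≡ d × proj₂ e ≡ c))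
  adj-elim H c d t with any-elim _ H t
  ... | e , me , te with ∨-elim {proj₁ e == c ∧ proj₂ e == d} te
  ... | inj₁ s = e , me , inj₁ (==⇒≡ (∧-elimˡ s) , ==⇒≡ (∧-elimʳ {proj₁ e == c} s))
  ... | inj₂ s = e , me , inj₂ (==⇒≡ (∧-elimˡ s) , ==⇒≡ (∧-elimʳ {proj₁ e == d} s))

  adj-intro : ∀ {n} (H : List (Arc n)) e → e ∈ H → T (adj H (proj₁ e) (proj₂ e))
  adj-intro H e me = any-intro _ H me (adj-here (proj₁ e) (proj₂ e) _)

  adj-merge : ∀ x y → T (adj F x y) → T (adj G (μ x) (μ y))
  adj-merge x y t with adj-elim F x y t
  ... | e , me , inj₁ (refl , refl) = adj-intro G (μ2 e) (∈-map⁺ μ2 me)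
  ... | e , me , inj₂ (refl , refl) = subst T (Connectivity.adj-sym G (μ (proj₁ e)) (μ (proj₂ e))) (adj-intro G (μ2 e) (∈-map⁺ μ2 me))

  adj-extend : ∀ x y → T (adj F x y) → T (adj F0 x y)
  adj-extend x y t = ∨-introʳ ((u == x ∧ v == y) ∨ (u == y ∧ v == x)) t

  conn-u-v : T (conn F0 u v)
  conn-u-v = R0.conn-step {u} {u} {v} (R0.conn-refl u) (∨-introˡ _ (adj-here u v _))

  μ-fibre-connected : ∀ x y → μ x ≡ μ y → T (conn F0 x y)
  μ-fibre-connected x y e with μ-fibres x y e
  ... | inj₁ refl = R0.conn-refl x
  ... | inj₂ (inj₁ refl , inj₁ refl) = R0.conn-refl u
  ... | inj₂ (inj₁ refl , inj₂ refl) = conn-u-v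
  ... | inj₂ (inj₂ refl , inj₁ refl) = R0.conn-sym conn-u-v
  ... | inj₂ (inj₂ refl , inj₂ refl) = R0.conn-refl v

  within-merge : ∀ k {a b} → R0.Within k a b → RG.Within k (μ a) (μ b)
  within-merge zero (R0.within t) = RG.within (≡⇒== (cong μ (==⇒≡ t)))
  within-merge (suc k) {a} {b} r with R0.within-cases r
  ... | inj₁ r' = RG.within-suc (within-merge k r')
  ... | inj₂ (c , r' , t) with adj-elim F0 c b t
  ... | e , here refl , inj₁ (refl , refl) = RG.within-suc (subst (RG.Within k (μ a)) (trans μ-u (sym μ-v)) (within-merge k r'))
  ... | e , here refl , inj₂ (refl , refl) = RG.within-suc (subst (RG.Within k (μ a)) (trans μ-v (sym μ-u)) (within-merge k r'))
  ... | e , there me , inj₁ (refl , refl) = RG.within-step (within-merge k r') (adj-merge _ _ (adj-intro F e me))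
  ... | e , there me , inj₂ (refl , refl) = RG.within-step (within-merge k r') (subst T (Connectivity.adj-sym G (μ (proj₁ e)) (μ (proj₂ e))) (adj-merge _ _ (adj-intro F e me)))

  within-unmerge : ∀ k {a b'} → RG.Within k (μ a) b' → ∀ b → μ b ≡ b' → T (conn F0 a b)
  within-unmerge zero (RG.within t) b e = μ-fibre-connected _ b (trans (==⇒≡ t) (sym e))
  within-unmerge (suc k) r b e with RG.within-cases r
  ... | inj₁ r' = within-unmerge k r' b e
  ... | inj₂ (c' , r' , t) with adj-elim G c' _ t
  ... | e' , me' , h with ∈-map⁻ μ2 me'
  ... | e0 , me0 , refl with h
  ... | inj₁ (refl , refl) = R0.conn-trans (R0.conn-step (within-unmerge k r' (proj₁ e0) refl) (adj-extend _ _ (adj-intro F e0 me0))) (μ-fibre-connected _ b (sym e))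
  ... | inj₂ (refl , refl) = R0.conn-trans (R0.conn-step (within-unmerge k r' (proj₂ e0) refl) (subst T (Connectivity.adj-sym F0 (proj₁ e0) (proj₂ e0)) (adj-extend _ _ (adj-intro F e0 me0)))) (μ-fibre-connected _ b (sym e))

  conn-eq : ∀ a b → conn F0 a b ≡ conn G (μ a) (μ b)
  conn-eq a b = T-ext (λ t → RG.within⇒conn (suc (suc m')) (within-merge (suc (suc m')) (R0.within t))) (λ t → within-unmerge (suc m') (RG.within t) b refl)

  conn-unmerge : ∀ a c' → T (conn G (μ a) c') → T (conn F0 a (punchIn v c'))
  conn-unmerge a c' t = subst T (sym (conn-eq a (punchIn v c'))) (subst (λ x → T (conn G (μ a) x)) (sym (μ-pi c')) t)

  μ-u≡μ-v : μ u ≡ μ v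
  μ-u≡μ-v = trans μ-u (sym μ-v)

  conn-u⇒conn-v : ∀ {a} → T (conn F0 a u) → T (conn F0 a v)
  conn-u⇒conn-v t = R0.conn-trans t conn-u-v

  conn-merge : ∀ {a b} → T (conn F0 a b) → T (conn G (μ a) (μ b))
  conn-merge {a} {b} t = subst T (conn-eq a b) t

  cyc-eq : ∀ a → isCycleComp F0 a ≡ isCycleComp G (μ a)
  cyc-eq a = T-ext fw bw
    where
    fw : T (isCycleComp F0 a) → T (isCycleComp G (μ a))
    fw t = SG.cyc-intro (μ a) λ c' tc' → h c' (conn-unmerge a c' tc') (trichotomy (punchIn v c'))
      where
      h : ∀ c' → T (conn F0 a (punchIn v c')) → Position (punchIn v c') → T (SG.deg1 c')
      h c' cb (inj₁ e) = subst (T ∘ SG.deg1) (trans (cong μ (sym e)) (μ-pi c'))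
        (deg1-intro G (μ u) (trans (sym in-u) (deg1⇒indeg F0 u (S0.cyc-elim a t u (subst (λ x → T (conn F0 a x)) e cb))))
                       (trans (cong (outdeg G) μ-u≡μ-v) (trans (sym out-v) (deg1⇒outdeg F0 v (S0.cyc-elim a t v (conn-u⇒conn-v (subst (λ x → T (conn F0 a x)) e cb)))))))
      h c' cb (inj₂ (inj₁ e)) = ⊥-elim (FP.punchInᵢ≢i v c' e)
      h c' cb (inj₂ (inj₂ (bu , bv))) = subst (T ∘ SG.deg1) (μ-pi c')
        (deg1-intro G _ (trans (sym (indeg-other _ bu bv)) (deg1⇒indeg F0 _ d)) (trans (sym (outdeg-other _ bu bv)) (deg1⇒outdeg F0 _ d)))
        where d = S0.cyc-elim a t (punchIn v c') cb
    bw : T (isCycleComp G (μ a)) → T (isCycleComp F0 a)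
    bw s = S0.cyc-intro a λ b tb → h b (SG.cyc-elim (μ a) s (μ b) (conn-merge tb)) (trichotomy b)
      where
      h : ∀ b → T (SG.deg1 (μ b)) → Position b → T (S0.deg1 b)
      h b d (inj₁ refl) = deg1-intro F0 u (trans in-u (deg1⇒indeg G _ d)) out-u
      h b d (inj₂ (inj₁ refl)) = deg1-intro F0 v in-v (trans out-v (deg1⇒outdeg G _ d))
      h b d (inj₂ (inj₂ (bu , bv))) = deg1-intro F0 b (trans (indeg-other b bu bv) (deg1⇒indeg G _ d)) (trans (outdeg-other b bu bv) (deg1⇒outdeg G _ d))

  reaches-merged-image : ∀ d → any (conn G d) (map μ (allFin (suc (suc m')))) ≡ true
  reaches-merged-image d = T⇒≡true (any-intro (conn G d) (map μ (allFin (suc (suc m')))) (∈-map⁺ μ (∈-allFin (punchIn v d))) (subst (λ x → T (conn G d x)) (sym (μ-pi d)) (RG.conn-refl d)))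

  count-reps-merge : (P : Fin (suc m') → Bool) → (∀ {a b} → T (conn G a b) → P a ≡ P b) →
    count (λ d → isRoot F0 d ∧ P (μ d)) (allFin (suc (suc m'))) ≡ count (λ d → isRoot G d ∧ P d) (allFin (suc m'))
  count-reps-merge P Pinv = trans (count-reps-transport S0.conn-equivalence SG.conn-equivalence (P ∘ μ) P (λ t → Pinv (conn-merge t)) Pinv μ conn-eq (λ _ → refl))
    (count-cong _ _ (allFin (suc m')) (λ d → trans (cong (λ t → isRoot G d ∧ (P d ∧ t)) (reaches-merged-image d)) (cong (isRoot G d ∧_) (∧-identityʳ _))))

  kc-eq : kc F0 ≡ kc G
  kc-eq = trans (count-cong _ _ (allFin (suc (suc m'))) (λ d → cong (isRoot F0 d ∧_) (cyc-eq d))) (count-reps-merge (isCycleComp G) (Components.cyc-inv G))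

  adm-eq : admissible F0 ≡ admissible G
  adm-eq = T-ext (λ t → SG.adm-intro λ c' → fw t c' (trichotomy (punchIn v c'))) (λ t → S0.adm-intro λ b → bw t b (trichotomy b))
    where
    fw' : T (admissible F0) → ∀ b → Position b → outdeg G (μ b) N.≤ 1 × indeg G (μ b) N.≤ 1
    fw' t b (inj₁ refl) = subst (N._≤ 1) (trans out-v (cong (outdeg G) (sym μ-u≡μ-v))) (proj₁ (S0.adm-elim t v)) , subst (N._≤ 1) in-u (proj₂ (S0.adm-elim t u))
    fw' t b (inj₂ (inj₁ refl)) = subst (N._≤ 1) out-v (proj₁ (S0.adm-elim t v)) , subst (N._≤ 1) (trans in-u (cong (indeg G) μ-u≡μ-v)) (proj₂ (S0.adm-elim t u))
    fw' t b (inj₂ (inj₂ (bu , bv))) = subst (N._≤ 1) (outdeg-other b bu bv) (proj₁ (S0.adm-elim t b)) , subst (N._≤ 1) (indeg-other b bu bv) (proj₂ (S0.adm-elim t b))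
    fw : T (admissible F0) → ∀ c' → Position (punchIn v c') → outdeg G c' N.≤ 1 × indeg G c' N.≤ 1
    fw t c' s = subst (λ c → outdeg G c N.≤ 1 × indeg G c N.≤ 1) (μ-pi c') (fw' t (punchIn v c') s)
    bw : T (admissible G) → ∀ b → Position b → outdeg F0 b N.≤ 1 × indeg F0 b N.≤ 1
    bw t b (inj₁ refl) = subst (N._≤ 1) (sym out-u) (s≤s z≤n) , subst (N._≤ 1) (sym in-u) (proj₂ (SG.adm-elim t (μ u)))
    bw t b (inj₂ (inj₁ refl)) = subst (N._≤ 1) (sym out-v) (proj₁ (SG.adm-elim t (μ v))) , subst (N._≤ 1) (sym in-v) (s≤s z≤n)
    bw t b (inj₂ (inj₂ (bu , bv))) = subst (N._≤ 1) (sym (outdeg-other b bu bv)) (proj₁ (SG.adm-elim t (μ b))) , subst (N._≤ 1) (sym (indeg-other b bu bv)) (proj₂ (SG.adm-elim t (μ b)))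

  mergedIsolated : Bool
  mergedIsolated = ⌊ indeg G (μ u) N.≟ 0 ⌋ ∧ ⌊ outdeg G (μ u) N.≟ 0 ⌋

  mergedIsolated⇒avoids : T mergedIsolated → All (Avoid (μ u)) G
  mergedIsolated⇒avoids t = All.tabulate λ {e} me → (λ eq → h1 (NP.≤-trans (count-pos (λ e → proj₁ e == μ u) G e me (≡⇒== eq)) (NP.≤-reflexive (≟⇒≡ (∧-elimʳ {⌊ indeg G (μ u) N.≟ 0 ⌋} t)))))
                               , (λ eq → h1 (NP.≤-trans (count-pos (λ e → proj₂ e == μ u) G e me (≡⇒== eq)) (NP.≤-reflexive (≟⇒≡ (∧-elimˡ t)))))
    where
    h1 : ¬ (1 N.≤ 0)
    h1 ()

  one : ∀ {k} → k ≢ 0 → k N.≤ 1 → k ≡ 1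
  one {zero} ne _ = ⊥-elim (ne refl)
  one {suc zero} _ _ = refl
  one {suc (suc k)} _ (s≤s ())

  out1-in-merged-component : T (admissible G) → ¬ T mergedIsolated → Σ (Fin (suc m')) λ c' → T (conn G (μ u) c') × outdeg G c' ≡ 1
  out1-in-merged-component adm niw with outdeg G (μ u) N.≟ 0
  ... | no o0 = μ u , RG.conn-refl (μ u) , one o0 (proj₁ (SG.adm-elim adm (μ u)))
  ... | yes o0 with indeg G (μ u) N.≟ 0
  ... | yes i0 = ⊥-elim (niw tt)
  ... | no i0 with count-witness (λ e → proj₂ e == μ u) G (h i0)
    where
    h : ∀ {k} → k ≢ 0 → 1 N.≤ k
    h {zero} ne = ⊥-elim (ne refl)
    h {suc k} _ = s≤s z≤n
  ... | e , me , te with ==⇒≡ te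
  ... | refl = proj₁ e , RG.conn-step (RG.conn-refl (proj₂ e)) (subst T (Connectivity.adj-sym G (proj₁ e) (proj₂ e)) (adj-intro G e me))
             , NP.≤-antisym (proj₁ (SG.adm-elim adm (proj₁ e))) (count-pos (λ x → proj₁ x == proj₁ e) G e me (≡⇒== refl))

  in0-in-preimage : ∀ a → T (isPathComp G (μ a)) → Σ (Fin (suc (suc m'))) λ b → T (conn F0 a b) × indeg F0 b ≡ 0
  in0-in-preimage a pG with SG.path-elim2 (μ a) pG
  ... | c' , cc' , ic' = punchIn v c' , conn-unmerge a c' cc' , h (trichotomy (punchIn v c'))
    where
    h : Position (punchIn v c') → indeg F0 (punchIn v c') ≡ 0
    h (inj₁ e) = trans (cong (indeg F0) e) (trans in-u (trans (cong (indeg G) (trans (cong μ (sym e)) (μ-pi c'))) (≟⇒≡ ic')))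
    h (inj₂ (inj₁ e)) = ⊥-elim (FP.punchInᵢ≢i v c' e)
    h (inj₂ (inj₂ (bu , bv))) = trans (indeg-other _ bu bv) (trans (cong (indeg G) (μ-pi c')) (≟⇒≡ ic'))

  path-eq : T (admissible G) → ∀ a → isPathComp F0 a ≡ (isPathComp G (μ a) ∨ (conn F0 a u ∧ mergedIsolated))
  path-eq adm a = T-ext fw bw
    where
    nuv : ¬ T (conn F0 a u) → ∀ {b} → T (conn F0 a b) → b ≢ u × b ≢ v
    nuv nc cb = (λ { refl → nc cb }) , (λ { refl → nc (R0.conn-trans cb (R0.conn-sym conn-u-v)) })
    fw : T (isPathComp F0 a) → T (isPathComp G (μ a) ∨ (conn F0 a u ∧ mergedIsolated))
    fw t with T? (conn F0 a u)
    ... | yes cau with T? mergedIsolated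
    ... | yes iw = ∨-introʳ (isPathComp G (μ a)) (∧-intro cau iw)
    ... | no niw with out1-in-merged-component adm niw | S0.path-elim2 a t
    ... | c' , cwc' , oc' | b , cab , ib = ∨-introˡ _ (SG.path-intro (μ a) c' (μ b) (RG.conn-trans (conn-merge cau) cwc') (≡⇒≟ oc') (conn-merge cab) (≡⇒≟ (h (trichotomy b))))
      where
      h : Position b → indeg G (μ b) ≡ 0
      h (inj₁ refl) = trans (sym in-u) (≟⇒≡ ib)
      h (inj₂ (inj₁ refl)) = ⊥-elim (NP.1+n≢0 (trans (sym in-v) (≟⇒≡ ib)))
      h (inj₂ (inj₂ (bu , bv))) = trans (sym (indeg-other b bu bv)) (≟⇒≡ ib)
    fw t | no ncau with S0.path-elim1 a t | S0.path-elim2 a t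
    ... | b , cb , ob | b' , cb' , ib' = ∨-introˡ _ (SG.path-intro (μ a) (μ b) (μ b') (conn-merge cb) (≡⇒≟ (trans (sym (outdeg-other b (proj₁ (nuv ncau cb)) (proj₂ (nuv ncau cb)))) (≟⇒≡ ob)))
                                                       (conn-merge cb') (≡⇒≟ (trans (sym (indeg-other b' (proj₁ (nuv ncau cb')) (proj₂ (nuv ncau cb')))) (≟⇒≡ ib'))))
    bw : T (isPathComp G (μ a) ∨ (conn F0 a u ∧ mergedIsolated)) → T (isPathComp F0 a)
    bw s with ∨-elim {isPathComp G (μ a)} s
    ... | inj₂ s' = S0.path-intro a u u (∧-elimˡ s') (≡⇒≟ out-u) (∧-elimˡ s') (≡⇒≟ (trans in-u (≟⇒≡ (∧-elimˡ (∧-elimʳ {conn F0 a u} s')))))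
    ... | inj₁ pG with in0-in-preimage a pG
    ... | b' , cb' , ib' with T? (conn F0 a u)
    ... | yes cau = S0.path-intro a u b' cau (≡⇒≟ out-u) cb' (≡⇒≟ ib')
    ... | no ncau with SG.path-elim1 (μ a) pG
    ... | c' , cc' , oc' = S0.path-intro a (punchIn v c') b' (conn-unmerge a c' cc')
            (≡⇒≟ (trans (outdeg-other _ (proj₁ (nuv ncau (conn-unmerge a c' cc'))) (proj₂ (nuv ncau (conn-unmerge a c' cc')))) (trans (cong (outdeg G) (μ-pi c')) (≟⇒≡ oc')))) cb' (≡⇒≟ ib')

  kp-eq : T (admissible G) → kp F0 ≡ kp G N.+ 𝟙 mergedIsolated
  kp-eq adm = begin
      count (λ d → isRoot F0 d ∧ isPathComp F0 d) (allFin (suc (suc m')))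
        ≡⟨ count-cong _ _ (allFin (suc (suc m'))) (λ d → trans (cong (isRoot F0 d ∧_) (path-eq adm d)) (∧-distribˡ-∨ (isRoot F0 d) _ _)) ⟩
      count (λ d → (isRoot F0 d ∧ isPathComp G (μ d)) ∨ (isRoot F0 d ∧ (conn F0 d u ∧ mergedIsolated))) (allFin (suc (suc m')))
        ≡⟨ count-∨ _ _ (allFin (suc (suc m'))) disjoint ⟩
      count (λ d → isRoot F0 d ∧ isPathComp G (μ d)) (allFin (suc (suc m'))) N.+ count (λ d → isRoot F0 d ∧ (conn F0 d u ∧ mergedIsolated)) (allFin (suc (suc m')))
        ≡⟨ cong₂ N._+_ (count-reps-merge (isPathComp G) (Components.path-inv G)) count-class-of-u ⟩
      kp G N.+ 𝟙 mergedIsolated ∎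
    where
    open ≡-Reasoning
    ∧-rotate : ∀ x y z → (x ∧ (y ∧ z)) ≡ (z ∧ (x ∧ y))
    ∧-rotate true true true = refl
    ∧-rotate true true false = refl
    ∧-rotate true false true = refl
    ∧-rotate true false false = refl
    ∧-rotate false true true = refl
    ∧-rotate false true false = refl
    ∧-rotate false false true = refl
    ∧-rotate false false false = refl
    count-class-of-u : count (λ d → isRoot F0 d ∧ (conn F0 d u ∧ mergedIsolated)) (allFin (suc (suc m'))) ≡ 𝟙 mergedIsolated
    count-class-of-u = begin
      count (λ d → isRoot F0 d ∧ (conn F0 d u ∧ mergedIsolated)) (allFin (suc (suc m')))
        ≡⟨ count-cong _ _ (allFin (suc (suc m'))) (λ d → ∧-rotate (isRoot F0 d) (conn F0 d u) mergedIsolated) ⟩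
      count (λ d → mergedIsolated ∧ (isRoot F0 d ∧ conn F0 d u)) (allFin (suc (suc m')))
        ≡⟨ count-const∧ mergedIsolated (λ d → isRoot F0 d ∧ conn F0 d u) (allFin (suc (suc m'))) ⟩
      𝟙 mergedIsolated N.* count (λ d → isRoot F0 d ∧ conn F0 d u) (allFin (suc (suc m')))
        ≡⟨ cong (𝟙 mergedIsolated N.*_) (LeastRepresentatives.count-reps-of-class S0.conn-equivalence u) ⟩
      𝟙 mergedIsolated N.* 1
        ≡⟨ NP.*-identityʳ _ ⟩
      𝟙 mergedIsolated ∎
    disjoint : ∀ d → T (isRoot F0 d ∧ isPathComp G (μ d)) → T (isRoot F0 d ∧ (conn F0 d u ∧ mergedIsolated)) → ⊥
    disjoint d p q = subst T (trans (Components.path-inv G (conn-merge (∧-elimˡ (∧-elimʳ {isRoot F0 d} q)))) (DeleteIsolated.path-isolated (μ u) G (mergedIsolated⇒avoids (∧-elimʳ {conn F0 d u} (∧-elimʳ {isRoot F0 d} q))))) (∧-elimʳ {isRoot F0 d} p)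

  weight-eq : ∀ X Y Z → weight X Y Z F0 ≡ X * weight X Y Z G + X * (Z - 1ℚ) * onlyIf mergedIsolated (weight X Y Z G)
  weight-eq X Y Z = weight-arc-factor X Y Z F0 G mergedIsolated adm-eq (cong suc (sym (LP.length-map μ2 F))) kc-eq kp-eq

punchOut-punchOut-comm : ∀ {k} (u v a : Fin (suc (suc k))) (vu : v ≢ u) (va : v ≢ a) (ua : u ≢ a) (uv : u ≢ v)
  (p1 : punchOut vu ≢ punchOut va) (p2 : punchOut uv ≢ punchOut ua) →
  punchOut {i = punchOut vu} {j = punchOut va} p1 ≡ punchOut {i = punchOut uv} {j = punchOut ua} p2
punchOut-punchOut-comm Fin.zero Fin.zero a vu va ua uv p1 p2 = ⊥-elim (vu refl)
punchOut-punchOut-comm Fin.zero (Fin.suc v) Fin.zero vu va ua uv p1 p2 = ⊥-elim (ua refl)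
punchOut-punchOut-comm Fin.zero (Fin.suc v) (Fin.suc a) vu va ua uv p1 p2 = FP.punchOut-cong v refl
punchOut-punchOut-comm (Fin.suc u) Fin.zero Fin.zero vu va ua uv p1 p2 = ⊥-elim (va refl)
punchOut-punchOut-comm (Fin.suc u) Fin.zero (Fin.suc a) vu va ua uv p1 p2 = FP.punchOut-cong u refl
punchOut-punchOut-comm {zero} (Fin.suc Fin.zero) (Fin.suc Fin.zero) a vu va ua uv p1 p2 = ⊥-elim (vu refl)
punchOut-punchOut-comm {suc k} (Fin.suc u) (Fin.suc v) Fin.zero vu va ua uv p1 p2 = refl
punchOut-punchOut-comm {suc k} (Fin.suc u) (Fin.suc v) (Fin.suc a) vu va ua uv p1 p2 =
  cong Fin.suc (punchOut-punchOut-comm u v a (vu ∘ cong Fin.suc) (va ∘ cong Fin.suc) (ua ∘ cong Fin.suc) (uv ∘ cong Fin.suc) (p1 ∘ cong Fin.suc) (p2 ∘ cong Fin.suc))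

contractArcs-keep : ∀ {m} {u v : Fin (suc m)} (u≢v : u ≢ v) (a b : Fin (suc m)) (es : List (Arc (suc m))) → a ≢ u → b ≢ v →
  contractArcs u≢v ((a , b) ∷ es) ≡ mergeArc u≢v (a , b) ∷ contractArcs u≢v es
contractArcs-keep {u = u} {v} u≢v a b es au bv rewrite dec-false (a FP.≟ u) au | dec-false (b FP.≟ v) bv = refl

contractArcs-drop-tail : ∀ {m} {u v : Fin (suc m)} (u≢v : u ≢ v) (a b : Fin (suc m)) (es : List (Arc (suc m))) → a ≡ u →
  contractArcs u≢v ((a , b) ∷ es) ≡ contractArcs u≢v es
contractArcs-drop-tail {u = u} u≢v a b es au rewrite dec-true (a FP.≟ u) au = refl

contractArcs-drop-head : ∀ {m} {u v : Fin (suc m)} (u≢v : u ≢ v) (a b : Fin (suc m)) (es : List (Arc (suc m))) → b ≡ v →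
  contractArcs u≢v ((a , b) ∷ es) ≡ contractArcs u≢v es
contractArcs-drop-head {u = u} {v} u≢v a b es bv rewrite dec-true (b FP.≟ v) bv with does (a FP.≟ u)
... | true = refl
... | false = refl

¬both-≢ : ∀ {n} {u v : Fin n} a b → ¬ T (not (a == u) ∧ not (b == v)) → a ≡ u ⊎ b ≡ v
¬both-≢ {u = u} {v} a b nt with a FP.≟ u | b FP.≟ v
... | yes a≡u | _ = inj₁ a≡u
... | no _ | yes b≡v = inj₂ b≡v
... | no _ | no _ = ⊥-elim (nt tt)

-- The common shape of delVertex and contractArcs: drop the arcs failing keep,
-- relabel the others.
sumBy-subLists-selective : {A B : Set} (keep : A → Bool) (op : List A → List B) → op [] ≡ [] →
  (∀ a → T (keep a) → Σ B λ b → ∀ L → op (a ∷ L) ≡ b ∷ op L) →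
  (∀ a → ¬ T (keep a) → ∀ L → op (a ∷ L) ≡ op L) →
  (g : List B → ℚ) (L : List A) →
  sumBy g (subLists (op L)) ≡ sumBy (λ F → onlyIf (all keep F) (g (op F))) (subLists L)
sumBy-subLists-selective keep op op[] kept dropped g [] rewrite op[] = refl
sumBy-subLists-selective {A} {B} keep op op[] kept dropped g (a ∷ L) with T? (keep a)
... | yes ka = begin
    sumBy g (subLists (op (a ∷ L)))                                    ≡⟨ cong (sumBy g ∘ subLists) (op-a L) ⟩
    sumBy g (subLists (b ∷ op L))                                      ≡⟨ sumBy-subLists-∷ g b (op L) ⟩
    sumBy g (subLists (op L)) + sumBy (g ∘ (b ∷_)) (subLists (op L))
      ≡⟨ cong₂ _+_ (sumBy-subLists-selective keep op op[] kept dropped g L) (sumBy-subLists-selective keep op op[] kept dropped (g ∘ (b ∷_)) L) ⟩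
    sumBy G (subLists L) + sumBy (λ F → onlyIf (all keep F) (g (b ∷ op F))) (subLists L)
      ≡⟨ cong (sumBy G (subLists L) +_) (sumBy-cong _ _ (subLists L) through-a) ⟩
    sumBy G (subLists L) + sumBy (G ∘ (a ∷_)) (subLists L)             ≡⟨ sumBy-subLists-∷ G a L ⟨
    sumBy G (subLists (a ∷ L))                                         ∎
  where
  open ≡-Reasoning
  G : List A → ℚ
  G F = onlyIf (all keep F) (g (op F))
  b : B
  b = proj₁ (kept a ka)
  op-a : ∀ L → op (a ∷ L) ≡ b ∷ op L
  op-a = proj₂ (kept a ka)
  through-a : ∀ F → onlyIf (all keep F) (g (b ∷ op F)) ≡ G (a ∷ F)
  through-a F = trans (cong (λ t → onlyIf (all keep F) (g t)) (sym (op-a F)))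
                      (cong (λ k → onlyIf (k ∧ all keep F) (g (op (a ∷ F)))) (sym (T⇒≡true ka)))
... | no ¬ka = begin
    sumBy g (subLists (op (a ∷ L)))  ≡⟨ cong (sumBy g ∘ subLists) (dropped a ¬ka L) ⟩
    sumBy g (subLists (op L))        ≡⟨ sumBy-subLists-selective keep op op[] kept dropped g L ⟩
    sumBy G (subLists L)             ≡⟨ sumBy-subLists-∷-skip G a L (λ F → cong (λ k → onlyIf (k ∧ all keep F) (g (op (a ∷ F)))) (¬T⇒≡false ¬ka)) ⟨
    sumBy G (subLists (a ∷ L))       ∎
  where
  open ≡-Reasoning
  G : List A → ℚ
  G F = onlyIf (all keep F) (g (op F))

sumBy-subLists-delVertex : ∀ {m} (w : Fin (suc m)) (g : List (Arc m) → ℚ) (L : List (Arc (suc m))) →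
  sumBy g (subLists (delVertex w L)) ≡ sumBy (λ F → onlyIf (avoids w F) (g (delVertex w F))) (subLists L)
sumBy-subLists-delVertex w = sumBy-subLists-selective (avoidsArc w) (delVertex w) refl kept dropped
  where
  kept : ∀ e → T (avoidsArc w e) → Σ _ λ e′ → ∀ L → delVertex w (e ∷ L) ≡ e′ ∷ delVertex w L
  kept (a , b) t = _ , λ L → delVertex-keep w a b L (λ e → not-elim (∧-elimˡ t) (≡⇒== e)) (λ e → not-elim (∧-elimʳ {not (a == w)} t) (≡⇒== e))
  dropped : ∀ e → ¬ T (avoidsArc w e) → ∀ L → delVertex w (e ∷ L) ≡ delVertex w L
  dropped (a , b) nt L = delVertex-drop w a b L (¬both-≢ a b nt)

sumBy-subLists-contractArcs : ∀ {m} {u v : Fin (suc m)} (u≢v : u ≢ v) (g : List (Arc m) → ℚ) (L : List (Arc (suc m))) →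
  sumBy g (subLists (contractArcs u≢v L)) ≡ sumBy (λ F → onlyIf (compatible u v F) (g (map (mergeArc u≢v) F))) (subLists L)
sumBy-subLists-contractArcs {u = u} {v} u≢v g L =
  trans (sumBy-subLists-selective (compatibleArc u v) (contractArcs u≢v) refl kept dropped g L)
        (sumBy-cong _ _ (subLists L) on-compatible)
  where
  kept : ∀ e → T (compatibleArc u v e) → Σ _ λ e′ → ∀ L → contractArcs u≢v (e ∷ L) ≡ e′ ∷ contractArcs u≢v L
  kept (a , b) t = _ , λ L → contractArcs-keep u≢v a b L (λ e → not-elim (∧-elimˡ t) (≡⇒== e)) (λ e → not-elim (∧-elimʳ {not (a == u)} t) (≡⇒== e))
  dropped : ∀ e → ¬ T (compatibleArc u v e) → ∀ L → contractArcs u≢v (e ∷ L) ≡ contractArcs u≢v L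
  dropped (a , b) nt L with ¬both-≢ a b nt
  ... | inj₁ a≡u = contractArcs-drop-tail u≢v a b L a≡u
  ... | inj₂ b≡v = contractArcs-drop-head u≢v a b L b≡v
  contractArcs-compatible : ∀ F → T (compatible u v F) → contractArcs u≢v F ≡ map (mergeArc u≢v) F
  contractArcs-compatible [] _ = refl
  contractArcs-compatible ((a , b) ∷ F) t =
    trans (contractArcs-keep u≢v a b F (λ e → not-elim (∧-elimˡ (∧-elimˡ t)) (≡⇒== e)) (λ e → not-elim (∧-elimʳ {not (a == u)} (∧-elimˡ t)) (≡⇒== e)))
          (cong (mergeArc u≢v (a , b) ∷_) (contractArcs-compatible F (∧-elimʳ {compatibleArc u v (a , b)} t)))
  on-compatible : ∀ F → onlyIf (compatible u v F) (g (contractArcs u≢v F)) ≡ onlyIf (compatible u v F) (g (map (mergeArc u≢v) F))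
  on-compatible F with T? (compatible u v F)
  ... | yes t = cong (λ x → onlyIf (compatible u v F) (g x)) (contractArcs-compatible F t)
  ... | no nt rewrite ¬T⇒≡false nt = refl

-- The merged vertex is isolated exactly for subgraphs of D†e

mergeInto-reindex : ∀ {m} {u v : Fin (suc m)} (u≢v : u ≢ v) x (p : x ≢ v) → mergeInto u≢v x ≡ reindex v x p
mergeInto-reindex {v = v} u≢v x p with x FP.≟ v
... | yes e = ⊥-elim (p e)
... | no q = FP.punchOut-cong v refl

delete-merged≡delete-both : ∀ {m'} {u v : Fin (suc (suc m'))} (u≢v : u ≢ v) (F : List (Arc (suc (suc m')))) → All (Avoid u) F → All (Avoid v) F →
  delVertex (reindex v u u≢v) (map (mergeArc u≢v) F) ≡ delVertex (punchOut {i = u} {j = v} u≢v) (delVertex u F)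
delete-merged≡delete-both u≢v [] _ _ = refl
delete-merged≡delete-both {m'} {u} {v} u≢v ((a , b) ∷ F) ((au , bu) ∷ avu) ((av , bv) ∷ avv) = begin
    delVertex w (mergeArc u≢v (a , b) ∷ map (mergeArc u≢v) F)
      ≡⟨ cong (λ e → delVertex w (e ∷ map (mergeArc u≢v) F)) (cong₂ _,_ (mergeInto-reindex u≢v a av) (mergeInto-reindex u≢v b bv)) ⟩
    delVertex w ((reindex v a av , reindex v b bv) ∷ map (mergeArc u≢v) F)
      ≡⟨ delVertex-keep w (reindex v a av) (reindex v b bv) (map (mergeArc u≢v) F) (nw a au av) (nw b bu bv) ⟩
    (reindex w (reindex v a av) (nw a au av) , reindex w (reindex v b bv) (nw b bu bv)) ∷ delVertex w (map (mergeArc u≢v) F)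
      ≡⟨ cong₂ _∷_ (cong₂ _,_ (comm a au av) (comm b bu bv)) (delete-merged≡delete-both u≢v F avu avv) ⟩
    (reindex pv (reindex u a au) (np a au av) , reindex pv (reindex u b bu) (np b bu bv)) ∷ delVertex pv (delVertex u F)
      ≡⟨ delVertex-keep pv (reindex u a au) (reindex u b bu) (delVertex u F) (np a au av) (np b bu bv) ⟨
    delVertex pv ((reindex u a au , reindex u b bu) ∷ delVertex u F)
      ≡⟨ cong (delVertex pv) (delVertex-keep u a b F au bu) ⟨
    delVertex pv (delVertex u ((a , b) ∷ F)) ∎
  where
  open ≡-Reasoning
  w : Fin (suc m')
  w = reindex v u u≢v
  pv : Fin (suc m')
  pv = punchOut {i = u} {j = v} u≢v
  nw : ∀ x → x ≢ u → (p : x ≢ v) → reindex v x p ≢ w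
  nw x xu p e = xu (FP.punchOut-injective (≢-sym p) (≢-sym u≢v) e)
  np : ∀ x → (p : x ≢ u) → x ≢ v → reindex u x p ≢ pv
  np x p xv e = xv (FP.punchOut-injective (≢-sym p) u≢v e)
  comm : ∀ x (xu : x ≢ u) (xv : x ≢ v) → reindex w (reindex v x xv) (nw x xu xv) ≡ reindex pv (reindex u x xu) (np x xu xv)
  comm x xu xv = punchOut-punchOut-comm u v x (≢-sym u≢v) (≢-sym xv) (≢-sym xu) u≢v _ _

avoids-second⇒ : ∀ {m} {u v : Fin (suc m)} (u≢v : u ≢ v) (F : List (Arc (suc m))) → All (Avoid u) F → T (avoids (punchOut {i = u} {j = v} u≢v) (delVertex u F)) → All (Avoid v) F
avoids-second⇒ u≢v [] _ _ = []
avoids-second⇒ {u = u} {v} u≢v ((a , b) ∷ F) ((au , bu) ∷ avu) t rewrite delVertex-keep u a b F au bu =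
  ((λ e → not-elim (∧-elimˡ (∧-elimˡ t)) (≡⇒== (FP.punchOut-cong u {i≢j = ≢-sym au} {i≢k = u≢v} e)))
  , (λ e → not-elim (∧-elimʳ {not (reindex u a au == punchOut u≢v)} (∧-elimˡ t)) (≡⇒== (FP.punchOut-cong u {i≢j = ≢-sym bu} {i≢k = u≢v} e))))
  ∷ avoids-second⇒ u≢v F avu (∧-elimʳ {not (reindex u a au == punchOut u≢v) ∧ not (reindex u b bu == punchOut u≢v)} t)

avoids-second⇐ : ∀ {m} {u v : Fin (suc m)} (u≢v : u ≢ v) (F : List (Arc (suc m))) → All (Avoid u) F → All (Avoid v) F → T (avoids (punchOut {i = u} {j = v} u≢v) (delVertex u F))
avoids-second⇐ {u = u} {v} u≢v F avu avv = avoids-intro _ _ (h F avu avv)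
  where
  h : ∀ F → All (Avoid u) F → All (Avoid v) F → All (Avoid (punchOut u≢v)) (delVertex u F)
  h [] _ _ = []
  h ((a , b) ∷ F) ((au , bu) ∷ avu) ((av , bv) ∷ avv) rewrite delVertex-keep u a b F au bu =
    ((λ e → av (FP.punchOut-injective _ u≢v e)) , (λ e → bv (FP.punchOut-injective _ u≢v e))) ∷ h F avu avv

compatible-elim : ∀ {n} (u v : Fin n) F → T (compatible u v F) → All (Compatible u v) F
compatible-elim u v [] _ = []
compatible-elim u v ((a , b) ∷ F) t = ((λ e → not-elim (∧-elimˡ (∧-elimˡ t)) (≡⇒== e)) , (λ e → not-elim (∧-elimʳ {not (a == u)} (∧-elimˡ t)) (≡⇒== e))) ∷ compatible-elim u v F (∧-elimʳ {not (a == u) ∧ not (b == v)} t)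

compatible-intro : ∀ {n} (u v : Fin n) F → All (Avoid u) F → All (Avoid v) F → T (compatible u v F)
compatible-intro u v [] _ _ = tt
compatible-intro u v ((a , b) ∷ F) ((au , _) ∷ avu) ((_ , bv) ∷ avv) = ∧-intro (∧-intro (not-intro (λ t → au (==⇒≡ t))) (not-intro (λ t → bv (==⇒≡ t)))) (compatible-intro u v F avu avv)

module MergedIsolated {m'} {u v : Fin (suc (suc m'))} (u≢v : u ≢ v) (F : List (Arc (suc (suc m')))) (ap : All (Compatible u v) F) where
  open Contract u≢v F ap
  pv : Fin (suc m')
  pv = punchOut {i = u} {j = v} u≢v

  inF-u : indeg F u ≡ indeg G (μ u)
  inF-u = trans (sym (cong (N._+ indeg F u) (cong 𝟙 (≢⇒==false (λ e → u≢v (sym e)))))) (trans (sym (count-∷ _ (u , v) F)) in-u)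
  outF-v : outdeg F v ≡ outdeg G (μ u)
  outF-v = trans (sym (cong (N._+ outdeg F v) (cong 𝟙 (≢⇒==false u≢v)))) (trans (sym (count-∷ _ (u , v) F)) (trans out-v (cong (outdeg G) (sym μ-u≡μ-v))))

  isolated⇒avoids-both : T mergedIsolated → All (Avoid u) F × All (Avoid v) F
  isolated⇒avoids-both t = zipA ap (count≡0⇒none _ F (trans inF-u (≟⇒≡ (∧-elimˡ t)))) (count≡0⇒none _ F (trans outF-v (≟⇒≡ (∧-elimʳ {⌊ indeg G (μ u) N.≟ 0 ⌋} t))))
    where
    zipA : ∀ {H} → All (Compatible u v) H → All (λ e → ¬ T (proj₂ e == u)) H → All (λ e → ¬ T (proj₁ e == v)) H → All (Avoid u) H × All (Avoid v) H
    zipA [] [] [] = [] , []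
    zipA ((pu , pv') ∷ a1) (h2 ∷ a2) (h3 ∷ a3) = let r = zipA a1 a2 a3 in
      ((pu , (λ e → h2 (≡⇒== e))) ∷ proj₁ r) , (((λ e → h3 (≡⇒== e)) , pv') ∷ proj₂ r)

  avoids-both⇒isolated : All (Avoid u) F → All (Avoid v) F → T mergedIsolated
  avoids-both⇒isolated avu avv = ∧-intro (≡⇒≟ (trans (sym inF-u) (indeg-avoided u F avu))) (≡⇒≟ (trans (sym outF-v) (outdeg-avoided v F avv)))

  mergedIsolated≡avoids-both : mergedIsolated ≡ (avoids u F ∧ avoids pv (delVertex u F))
  mergedIsolated≡avoids-both = T-ext (λ t → let r = isolated⇒avoids-both t in ∧-intro (avoids-intro u F (proj₁ r)) (avoids-second⇐ u≢v F (proj₁ r) (proj₂ r)))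
                (λ t → let avu = avoids-elim u F (∧-elimˡ t) in avoids-both⇒isolated avu (avoids-second⇒ u≢v F avu (∧-elimʳ {avoids u F} t)))

  weight-merged≡weight-dagger : ∀ X Y Z → T mergedIsolated → weight X Y Z G ≡ weight X Y Z (delVertex pv (delVertex u F))
  weight-merged≡weight-dagger X Y Z t = begin
    weight X Y Z G                                    ≡⟨ DeleteIsolated.weight-eq (μ u) G (mergedIsolated⇒avoids t) X Y Z ⟩
    weight X Y Z (delVertex (μ u) G)                  ≡⟨ cong (λ z → weight X Y Z (delVertex z G)) μ-u ⟩
    weight X Y Z (delVertex w G)                      ≡⟨ cong (weight X Y Z) (delete-merged≡delete-both u≢v F avu avv) ⟩
    weight X Y Z (delVertex pv (delVertex u F))       ∎
    where
    open ≡-Reasoning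
    avu : All (Avoid u) F
    avu = proj₁ (isolated⇒avoids-both t)
    avv : All (Avoid v) F
    avv = proj₂ (isolated⇒avoids-both t)

  dagger-term : ∀ X Y Z → onlyIf (avoids u F ∧ avoids pv (delVertex u F)) (weight X Y Z (delVertex pv (delVertex u F))) ≡ onlyIf mergedIsolated (weight X Y Z G)
  dagger-term X Y Z rewrite sym mergedIsolated≡avoids-both = h mergedIsolated refl
    where
    h : ∀ b → mergedIsolated ≡ b → onlyIf b (weight X Y Z (delVertex pv (delVertex u F))) ≡ onlyIf b (weight X Y Z G)
    h true e = sym (weight-merged≡weight-dagger X Y Z (subst T (sym e) tt))
    h false e = refl

outdeg≥2⇒inadmissible : ∀ {n} (H : List (Arc n)) x → 2 N.≤ outdeg H x → admissible H ≡ false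
outdeg≥2⇒inadmissible H x le = ¬T⇒≡false λ t → h (NP.≤-trans le (proj₁ (Components.adm-elim H t x)))
  where
  h : ¬ (2 N.≤ 1)
  h (s≤s ())

indeg≥2⇒inadmissible : ∀ {n} (H : List (Arc n)) x → 2 N.≤ indeg H x → admissible H ≡ false
indeg≥2⇒inadmissible H x le = ¬T⇒≡false λ t → h (NP.≤-trans le (proj₂ (Components.adm-elim H t x)))
  where
  h : ¬ (2 N.≤ 1)
  h (s≤s ())

outdeg-∷-tail : ∀ {n} (u v : Fin n) F → outdeg ((u , v) ∷ F) u ≡ suc (outdeg F u)
outdeg-∷-tail u v F = trans (count-∷ _ (u , v) F) (cong (λ t → 𝟙 t N.+ outdeg F u) (==-refl u))

indeg-∷-head : ∀ {n} (u v : Fin n) F → indeg ((u , v) ∷ F) v ≡ suc (indeg F v)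
indeg-∷-head u v F = trans (count-∷ _ (u , v) F) (cong (λ t → 𝟙 t N.+ indeg F v) (==-refl v))

-- Covers loops too: compatible u u is avoids u.
incompatible⇒inadmissible : ∀ {n} (u v : Fin n) F → ¬ T (compatible u v F) → admissible ((u , v) ∷ F) ≡ false
incompatible⇒inadmissible u v F nc with all-counterexample (compatibleArc u v) F nc
... | e , e∈F , ne with ¬both-≢ (proj₁ e) (proj₂ e) ne
... | inj₁ e-from-u = outdeg≥2⇒inadmissible ((u , v) ∷ F) u
      (subst (2 N.≤_) (sym (outdeg-∷-tail u v F)) (s≤s (count-pos _ F e e∈F (≡⇒== e-from-u))))
... | inj₂ e-into-v = indeg≥2⇒inadmissible ((u , v) ∷ F) v
      (subst (2 N.≤_) (sym (indeg-∷-head u v F)) (s≤s (count-pos _ F e e∈F (≡⇒== e-into-v))))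

weight-arc∷ : ∀ {m'} {u v : Fin (suc (suc m'))} (u≢v : u ≢ v) X Y Z (F : List (Arc (suc (suc m')))) →
  weight X Y Z ((u , v) ∷ F)
    ≡ onlyIf (compatible u v F)
        (X * weight X Y Z (map (mergeArc u≢v) F)
          + X * (Z - 1ℚ) * onlyIf (avoids u F ∧ avoids (punchOut u≢v) (delVertex u F)) (weight X Y Z (delVertex (punchOut u≢v) (delVertex u F))))
weight-arc∷ {u = u} {v} u≢v X Y Z F = onlyIf-intro (compatible u v F)
  (λ c → let ap = compatible-elim u v F c in
    trans (Contract.weight-eq u≢v F ap X Y Z)
          (cong (λ t → X * weight X Y Z (map (mergeArc u≢v) F) + X * (Z - 1ℚ) * t) (sym (MergedIsolated.dagger-term u≢v F ap X Y Z))))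
  (λ nc → weight-inadmissible X Y Z ((u , v) ∷ F) (incompatible⇒inadmissible u v F nc))

weight-loop∷ : ∀ {m} (u : Fin (suc m)) X Y Z (F : List (Arc (suc m))) →
  weight X Y Z ((u , u) ∷ F) ≡ onlyIf (avoids u F) (X * Y * weight X Y Z (delVertex u F))
weight-loop∷ u X Y Z F = onlyIf-intro (avoids u F)
  (λ a → let av = avoids-elim u F a in trans (AddLoop.weight-eq u F av X Y Z) (cong (X * Y *_) (DeleteIsolated.weight-eq u F av X Y Z)))
  (λ na → weight-inadmissible X Y Z ((u , u) ∷ F) (incompatible⇒inadmissible u u F na))

σπ′-loop : ∀ {m} (u : Fin (suc m)) (es : List (Arc (suc m))) X Y Z →
  σπ′ (suc m) ((u , u) ∷ es) X Y Z ≡ σπ′ (suc m) es X Y Z + X * Y * σπ′ m (delVertex u es) X Y Z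
σπ′-loop u es X Y Z = begin
    σπ′ _ ((u , u) ∷ es) X Y Z
      ≡⟨ sumBy-subLists-∷ (weight X Y Z) (u , u) es ⟩
    S + sumBy (λ F → weight X Y Z ((u , u) ∷ F)) (subLists es)
      ≡⟨ cong (S +_) (sumBy-cong _ _ (subLists es) (λ F → trans (weight-loop∷ u X Y Z F) (onlyIf-* _ (X * Y) _))) ⟩
    S + sumBy (λ F → X * Y * Dn F) (subLists es)
      ≡⟨ cong (S +_) (sumBy-* (X * Y) Dn (subLists es)) ⟩
    S + X * Y * sumBy Dn (subLists es)
      ≡⟨ cong (λ t → S + X * Y * t) (sumBy-subLists-delVertex u (weight X Y Z) es) ⟨
    S + X * Y * σπ′ _ (delVertex u es) X Y Z ∎
  where
  open ≡-Reasoning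
  S : ℚ
  S = σπ′ _ es X Y Z
  Dn : List (Arc _) → ℚ
  Dn F = onlyIf (avoids u F) (weight X Y Z (delVertex u F))

σπ′-arc : ∀ {m'} {u v : Fin (suc (suc m'))} (u≢v : u ≢ v) (es : List (Arc (suc (suc m')))) X Y Z →
  σπ′ (suc (suc m')) ((u , v) ∷ es) X Y Z ≡ σπ′ (suc (suc m')) es X Y Z + X * σπ′ (suc m') (contractArcs u≢v es) X Y Z
     + (X * (Z - 1ℚ)) * σπ′ m' (delVertex (punchOut {i = u} {j = v} u≢v) (delVertex u es)) X Y Z
σπ′-arc {m'} {u} {v} u≢v es X Y Z = begin
    σπ′ _ ((u , v) ∷ es) X Y Z
      ≡⟨ sumBy-subLists-∷ (weight X Y Z) (u , v) es ⟩
    S + sumBy (λ F → weight X Y Z ((u , v) ∷ F)) (subLists es)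
      ≡⟨ cong (S +_) (sumBy-cong _ _ (subLists es) (λ F → trans (weight-arc∷ u≢v X Y Z F) (distribute F))) ⟩
    S + sumBy (λ F → X * Cn F + K * Dn F) (subLists es)
      ≡⟨ cong (S +_) (sumBy-+ (λ F → X * Cn F) (λ F → K * Dn F) (subLists es)) ⟩
    S + (sumBy (λ F → X * Cn F) (subLists es) + sumBy (λ F → K * Dn F) (subLists es))
      ≡⟨ cong (S +_) (cong₂ _+_ (sumBy-* X Cn (subLists es)) (sumBy-* K Dn (subLists es))) ⟩
    S + (X * sumBy Cn (subLists es) + K * sumBy Dn (subLists es))
      ≡⟨ cong₂ (λ s t → S + (X * s + K * t)) (sumBy-subLists-contractArcs u≢v (weight X Y Z) es) dagger-sum ⟨
    S + (X * σπ′ _ (contractArcs u≢v es) X Y Z + K * σπ′ _ (Dg es) X Y Z)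
      ≡⟨ QP.+-assoc S _ _ ⟨
    S + X * σπ′ _ (contractArcs u≢v es) X Y Z + K * σπ′ _ (Dg es) X Y Z ∎
  where
  open ≡-Reasoning
  S : ℚ
  S = σπ′ _ es X Y Z
  pv : Fin (suc m')
  pv = punchOut {i = u} {j = v} u≢v
  K : ℚ
  K = X * (Z - 1ℚ)
  Aq : List (Arc (suc (suc m'))) → Bool
  Aq F = avoids u F ∧ avoids pv (delVertex u F)
  Dg : List (Arc (suc (suc m'))) → List (Arc m')
  Dg F = delVertex pv (delVertex u F)
  Cn Dn : List (Arc (suc (suc m'))) → ℚ
  Cn F = onlyIf (compatible u v F) (weight X Y Z (map (mergeArc u≢v) F))
  Dn F = onlyIf (Aq F) (weight X Y Z (Dg F))
  dagger⇒compatible : ∀ F → T (Aq F) → T (compatible u v F)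
  dagger⇒compatible F t = let avu = avoids-elim u F (∧-elimˡ t) in compatible-intro u v F avu (avoids-second⇒ u≢v F avu (∧-elimʳ {avoids u F} t))
  distribute : ∀ F → onlyIf (compatible u v F) (X * weight X Y Z (map (mergeArc u≢v) F) + K * Dn F) ≡ X * Cn F + K * Dn F
  distribute F = begin
    onlyIf (compatible u v F) (X * weight X Y Z (map (mergeArc u≢v) F) + K * Dn F)
      ≡⟨ onlyIf-+ (compatible u v F) _ _ ⟩
    onlyIf (compatible u v F) (X * weight X Y Z (map (mergeArc u≢v) F)) + onlyIf (compatible u v F) (K * Dn F)
      ≡⟨ cong₂ _+_ (onlyIf-* (compatible u v F) X _) (onlyIf-* (compatible u v F) K (Dn F)) ⟩
    X * Cn F + K * onlyIf (compatible u v F) (Dn F)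
      ≡⟨ cong (λ t → X * Cn F + K * t) (onlyIf-absorb (compatible u v F) (Aq F) _ (dagger⇒compatible F)) ⟩
    X * Cn F + K * Dn F ∎
  dagger-sum : σπ′ m' (Dg es) X Y Z ≡ sumBy Dn (subLists es)
  dagger-sum = begin
    σπ′ m' (Dg es) X Y Z
      ≡⟨ sumBy-subLists-delVertex pv (weight X Y Z) (delVertex u es) ⟩
    sumBy (λ F₁ → onlyIf (avoids pv F₁) (weight X Y Z (delVertex pv F₁))) (subLists (delVertex u es))
      ≡⟨ sumBy-subLists-delVertex u (λ F₁ → onlyIf (avoids pv F₁) (weight X Y Z (delVertex pv F₁))) es ⟩
    sumBy (λ F → onlyIf (avoids u F) (onlyIf (avoids pv (delVertex u F)) (weight X Y Z (Dg F)))) (subLists es)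
      ≡⟨ sumBy-cong _ _ (subLists es) (λ F → onlyIf-∧ (avoids u F) (avoids pv (delVertex u F)) (weight X Y Z (Dg F))) ⟩
    sumBy Dn (subLists es) ∎

σπ′-empty : ∀ n X Y Z → σπ′ n [] X Y Z ≡ 1ℚ
σπ′-empty n X Y Z = trans (QP.+-identityʳ (weight X Y Z E)) (trans (weight-admissible X Y Z E adm0) (cong₂ (λ a b → 1ℚ * pow Y a * pow Z b) kc0 kp0))
  where
  E : List (Arc n)
  E = []
  adm0 : admissible E ≡ true
  adm0 = T⇒≡true (Components.adm-intro E (λ b → z≤n , z≤n))
  kc0 : kc E ≡ 0
  kc0 = count-none _ (allFin n) (λ d → trans (cong (isRoot E d ∧_) (¬T⇒≡false λ t → Components.cyc-elim E d t d (Connectivity.conn-refl E d))) (∧-zeroʳ _))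
  kp0 : kp E ≡ 0
  kp0 = count-none _ (allFin n) (λ d → trans (cong (isRoot E d ∧_) (¬T⇒≡false λ t → proj₂ (proj₂ (Components.path-elim1 E d t)))) (∧-zeroʳ _))

length-delVertex≤ : ∀ {m} (w : Fin (suc m)) L → length (delVertex w L) N.≤ length L
length-delVertex≤ w L = LP.length-mapMaybe _ L

length-contractArcs≤ : ∀ {m} {u v : Fin (suc m)} (u≢v : u ≢ v) L → length (contractArcs u≢v L) N.≤ length L
length-contractArcs≤ u≢v L = length-map-filter≤ _ _ L
  where
  length-map-filter≤ : ∀ {P : A → Set} (f : A → B) (P? : Decidable P) xs → length (map f (filter P? xs)) N.≤ length xs
  length-map-filter≤ f P? xs = NP.≤-trans (NP.≤-reflexive (LP.length-map f (filter P? xs))) (LP.length-filter P? xs)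

-- Rescaling the cycle-path sum

module ScaledRecurrence (a p r X Y Z : ℚ)
  (loop : a * (X * Y) ≡ p + r) (arc : a * X ≡ p) (dagger : a * a * (X * (Z - 1ℚ)) ≡ r) where

  ξfuel≡scaled-σπ′ : ∀ k n (es : List (Arc n)) → length es N.≤ k → ξfuel a p r k n es ≡ pow a n * σπ′ n es X Y Z
  ξfuel≡scaled-σπ′ k n [] _ = sym (trans (cong (pow a n *_) (σπ′-empty n X Y Z)) (QP.*-identityʳ _))
  ξfuel≡scaled-σπ′ (suc k) zero ((() , _) ∷ es) le
  ξfuel≡scaled-σπ′ (suc k) (suc m) ((u , v) ∷ es) (s≤s le) with u FP.≟ v
  ... | yes refl = loop-step
    where
    open ≡-Reasoning
    ξ′ = ξfuel a p r k
    P = pow a m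
    S = σπ′ (suc m) es X Y Z
    S′ = σπ′ m (delVertex u es) X Y Z
    loop-step : ξ′ (suc m) es + p * ξ′ m (delVertex u es) + r * ξ′ m (delVertex u es)
              ≡ a * P * σπ′ (suc m) ((u , u) ∷ es) X Y Z
    loop-step = begin
      ξ′ (suc m) es + p * ξ′ m (delVertex u es) + r * ξ′ m (delVertex u es)
        ≡⟨ cong₂ (λ s t → s + p * t + r * t) (ξfuel≡scaled-σπ′ k (suc m) es le)
                 (ξfuel≡scaled-σπ′ k m (delVertex u es) (NP.≤-trans (length-delVertex≤ u es) le)) ⟩
      a * P * S + p * (P * S′) + r * (P * S′)
        ≡⟨ solve 4 (λ aPS p r PS′ → aPS :+ p :* PS′ :+ r :* PS′ := aPS :+ (p :+ r) :* PS′) refl (a * P * S) p r (P * S′) ⟩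
      a * P * S + (p + r) * (P * S′)
        ≡⟨ cong (λ t → a * P * S + t * (P * S′)) loop ⟨
      a * P * S + a * (X * Y) * (P * S′)
        ≡⟨ solve 6 (λ a P S X Y S′ → a :* P :* S :+ a :* (X :* Y) :* (P :* S′) := a :* P :* (S :+ X :* Y :* S′)) refl a P S X Y S′ ⟩
      a * P * (S + X * Y * S′)
        ≡⟨ cong (a * P *_) (σπ′-loop u es X Y Z) ⟨
      a * P * σπ′ (suc m) ((u , u) ∷ es) X Y Z ∎
  ... | no u≢v = arc-step m u≢v es le
    where
    arc-step : ∀ m {u v : Fin (suc m)} (u≢v : u ≢ v) (es : List (Arc (suc m))) → length es N.≤ k →
      ξfuel a p r k (suc m) es + p * ξfuel a p r k m (contractArcs u≢v es)
        + r * ξfuel a p r k (proj₁ (daggerArcs u≢v es)) (proj₂ (daggerArcs u≢v es))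
      ≡ pow a (suc m) * σπ′ (suc m) ((u , v) ∷ es) X Y Z
    arc-step zero {Fin.zero} {Fin.zero} u≢v es le = ⊥-elim (u≢v refl)
    arc-step (suc m′) {u} {v} u≢v es le = begin
      ξ′ (suc (suc m′)) es + p * ξ′ (suc m′) C + r * ξ′ m′ D
        ≡⟨ cong₃ (λ s t w → s + p * t + r * w) (ξfuel≡scaled-σπ′ k (suc (suc m′)) es le)
                 (ξfuel≡scaled-σπ′ k (suc m′) C (NP.≤-trans (length-contractArcs≤ u≢v es) le))
                 (ξfuel≡scaled-σπ′ k m′ D (NP.≤-trans (length-delVertex≤ _ (delVertex u es)) (NP.≤-trans (length-delVertex≤ u es) le))) ⟩
      a * (a * P) * S + p * (a * P * SC) + r * (P * SD)
        ≡⟨ cong₂ (λ s t → a * (a * P) * S + s * (a * P * SC) + t * (P * SD)) arc dagger ⟨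
      a * (a * P) * S + a * X * (a * P * SC) + a * a * (X * (Z - 1ℚ)) * (P * SD)
        ≡⟨ solve 7 (λ a P S X SC K SD → a :* (a :* P) :* S :+ a :* X :* (a :* P :* SC) :+ a :* a :* K :* (P :* SD)
                                       := a :* (a :* P) :* (S :+ X :* SC :+ K :* SD)) refl a P S X SC (X * (Z - 1ℚ)) SD ⟩
      a * (a * P) * (S + X * SC + X * (Z - 1ℚ) * SD)
        ≡⟨ cong (a * (a * P) *_) (σπ′-arc u≢v es X Y Z) ⟨
      a * (a * P) * σπ′ (suc (suc m′)) ((u , v) ∷ es) X Y Z ∎
      where
      open ≡-Reasoning
      ξ′ = ξfuel a p r k
      C = contractArcs u≢v es
      D = delVertex (punchOut u≢v) (delVertex u es)
      P = pow a m′
      S = σπ′ (suc (suc m′)) es X Y Z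
      SC = σπ′ (suc m′) C X Y Z
      SD = σπ′ m′ D X Y Z

*-/ₜ-cancel : ∀ p q → q ≢ 0ℚ → q * (p /ₜ q) ≡ p
*-/ₜ-cancel p q q≢0 with q QP.≟ 0ℚ
... | yes q≡0 = ⊥-elim (q≢0 q≡0)
... | no q≢0′ = begin
    q * (p * Q.1/ q)  ≡⟨ solve 3 (λ q p q⁻¹ → q :* (p :* q⁻¹) := p :* (q :* q⁻¹)) refl q p (Q.1/ q) ⟩
    p * (q * Q.1/ q)  ≡⟨ cong (p *_) (QP.*-inverseʳ q) ⟩
    p * 1ℚ            ≡⟨ QP.*-identityʳ p ⟩
    p                 ∎
  where
  open ≡-Reasoning
  instance
    q-nonZero : Q.NonZero q
    q-nonZero = Q.≢-nonZero q≢0′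

-- Also for r = 0, where both sides are 0.
*-/ₜ-assoc : ∀ p q r → p * (q /ₜ r) ≡ (p * q) /ₜ r
*-/ₜ-assoc p q r with r QP.≟ 0ℚ
... | yes _ = QP.*-zeroʳ p
... | no r≢0 = sym (QP.*-assoc p q _)

*-≢0 : ∀ {p q} → p ≢ 0ℚ → q ≢ 0ℚ → p * q ≢ 0ℚ
*-≢0 {p} {q} p≢0 q≢0 pq≡0 = p≢0 (begin
    p                    ≡⟨ QP.*-identityʳ p ⟨
    p * 1ℚ               ≡⟨ cong (p *_) (*-/ₜ-cancel 1ℚ q q≢0) ⟨
    p * (q * (1ℚ /ₜ q))  ≡⟨ QP.*-assoc p q _ ⟨
    p * q * (1ℚ /ₜ q)    ≡⟨ cong (_* (1ℚ /ₜ q)) pq≡0 ⟩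
    0ℚ * (1ℚ /ₜ q)       ≡⟨ QP.*-zeroˡ (1ℚ /ₜ q) ⟩
    0ℚ                   ∎)
  where open ≡-Reasoning

pow-* : ∀ a b n → pow a n * pow b n ≡ pow (a * b) n
pow-* a b zero = QP.*-identityˡ 1ℚ
pow-* a b (suc n) = trans (solve 4 (λ a b p q → (a :* p) :* (b :* q) := (a :* b) :* (p :* q)) refl a b (pow a n) (pow b n))
                          (cong ((a * b) *_) (pow-* a b n))

pow-1 : ∀ n → pow 1ℚ n ≡ 1ℚ
pow-1 zero = refl
pow-1 (suc n) = trans (QP.*-identityˡ _) (pow-1 n)

pow-inverse-cancel : ∀ a n → a ≢ 0ℚ → pow (1ℚ /ₜ a) n * pow a n ≡ 1ℚ
pow-inverse-cancel a n a≢0 = begin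
    pow (1ℚ /ₜ a) n * pow a n ≡⟨ pow-* (1ℚ /ₜ a) a n ⟩
    pow (1ℚ /ₜ a * a) n       ≡⟨ cong (λ t → pow t n) (trans (QP.*-comm _ a) (*-/ₜ-cancel 1ℚ a a≢0)) ⟩
    pow 1ℚ n                  ≡⟨ pow-1 n ⟩
    1ℚ                        ∎
  where open ≡-Reasoning

+1-1 : ∀ a → (a + 1ℚ) - 1ℚ ≡ a
+1-1 a = trans (QP.+-assoc a 1ℚ (Q.- 1ℚ)) (trans (cong (a +_) (QP.+-inverseʳ 1ℚ)) (QP.+-identityʳ a))

-1≢0 : ∀ y → y ≢ 1ℚ → y - 1ℚ ≢ 0ℚ
-1≢0 y y≢1 e = y≢1 (trans (sym (-1+1 y)) (trans (cong (_+ 1ℚ) e) (QP.+-identityˡ 1ℚ)))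

σπ′≡rescaled-ξ : ∀ n (es : List (Arc n)) (x y z : ℚ) → y ≢ 1ℚ → z ≢ 1ℚ →
  σπ′ n es x y z ≡ pow (1ℚ /ₜ ((y - 1ℚ) /ₜ (z - 1ℚ))) n
    * ξ (digraph n es) ((y - 1ℚ) /ₜ (z - 1ℚ)) (x * ((y - 1ℚ) /ₜ (z - 1ℚ))) (x * (((y - 1ℚ) * (y - 1ℚ)) /ₜ (z - 1ℚ)))
σπ′≡rescaled-ξ n es x y z y≢1 z≢1 = begin
    σπ′ n es x y z                                  ≡⟨ QP.*-identityˡ _ ⟨
    1ℚ * σπ′ n es x y z                             ≡⟨ cong (_* σπ′ n es x y z) (pow-inverse-cancel ρ n ρ≢0) ⟨
    pow (1ℚ /ₜ ρ) n * pow ρ n * σπ′ n es x y z      ≡⟨ QP.*-assoc (pow (1ℚ /ₜ ρ) n) _ _ ⟩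
    pow (1ℚ /ₜ ρ) n * (pow ρ n * σπ′ n es x y z)
      ≡⟨ cong (pow (1ℚ /ₜ ρ) n *_) (ScaledRecurrence.ξfuel≡scaled-σπ′ ρ (x * ρ) β x y z loop (QP.*-comm ρ x) dagger (length es) n es NP.≤-refl) ⟨
    pow (1ℚ /ₜ ρ) n * ξ (digraph n es) ρ (x * ρ) β ∎
  where
  open ≡-Reasoning
  d = y - 1ℚ
  e = z - 1ℚ
  ρ = d /ₜ e
  β = x * ((d * d) /ₜ e)
  eρ≡d : e * ρ ≡ d
  eρ≡d = *-/ₜ-cancel d e (-1≢0 z z≢1)
  ρ≢0 : ρ ≢ 0ℚ
  ρ≢0 ρ≡0 = -1≢0 y y≢1 (trans (sym eρ≡d) (trans (cong (e *_) ρ≡0) (QP.*-zeroʳ e)))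
  β≡xdρ : β ≡ x * (d * ρ)
  β≡xdρ = cong (x *_) (sym (*-/ₜ-assoc d d e))
  dagger : ρ * ρ * (x * e) ≡ β
  dagger = begin
    ρ * ρ * (x * e)  ≡⟨ solve 3 (λ ρ x e → ρ :* ρ :* (x :* e) := x :* (e :* ρ :* ρ)) refl ρ x e ⟩
    x * (e * ρ * ρ)  ≡⟨ cong (λ t → x * (t * ρ)) eρ≡d ⟩
    x * (d * ρ)      ≡⟨ β≡xdρ ⟨
    β                ∎
  loop : ρ * (x * y) ≡ x * ρ + β
  loop = begin
    ρ * (x * y)            ≡⟨ cong (λ t → ρ * (x * t)) (-1+1 y) ⟨
    ρ * (x * (d + 1ℚ))     ≡⟨ solve 3 (λ ρ x d → ρ :* (x :* (d :+ con 1ℚ)) := x :* ρ :+ x :* (d :* ρ)) refl ρ x d ⟩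
    x * ρ + x * (d * ρ)    ≡⟨ cong (x * ρ +_) β≡xdρ ⟨
    x * ρ + β              ∎

ξ≡rescaled-σπ′ : ∀ n (es : List (Arc n)) (x y z : ℚ) → x ≢ 0ℚ → y ≢ 0ℚ →
  ξ (digraph n es) x y z ≡ pow x n * σπ′ n es (y /ₜ x) ((y + z) /ₜ y) ((z /ₜ (x * y)) + 1ℚ)
ξ≡rescaled-σπ′ n es x y z x≢0 y≢0 =
  ScaledRecurrence.ξfuel≡scaled-σπ′ x y z X Y Z loop arc dagger (length es) n es NP.≤-refl
  where
  open ≡-Reasoning
  X = y /ₜ x
  Y = (y + z) /ₜ y
  W = z /ₜ (x * y)
  Z = W + 1ℚ
  arc : x * X ≡ y
  arc = *-/ₜ-cancel y x x≢0
  loop : x * (X * Y) ≡ y + z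
  loop = begin
    x * (X * Y)   ≡⟨ QP.*-assoc x X Y ⟨
    x * X * Y     ≡⟨ cong (_* Y) arc ⟩
    y * Y         ≡⟨ *-/ₜ-cancel (y + z) y y≢0 ⟩
    y + z         ∎
  dagger : x * x * (X * (Z - 1ℚ)) ≡ z
  dagger = begin
    x * x * (X * (Z - 1ℚ))  ≡⟨ cong (λ t → x * x * (X * t)) (+1-1 W) ⟩
    x * x * (X * W)         ≡⟨ solve 4 (λ x X y W → x :* x :* (X :* W) := x :* (x :* X :* W)) refl x X y W ⟩
    x * (x * X * W)         ≡⟨ cong (λ t → x * (t * W)) arc ⟩
    x * (y * W)             ≡⟨ QP.*-assoc x y W ⟨
    x * y * W               ≡⟨ *-/ₜ-cancel z (x * y) (*-≢0 x≢0 y≢0) ⟩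
    z                       ∎

theorem4p2 : (D : Digraph) →
    ((x y z : ℚ) → y ≢ 1ℚ → z ≢ 1ℚ →
      σπ D x y z
        ≡ pow (1ℚ /ₜ ((y - 1ℚ) /ₜ (z - 1ℚ))) (nV D)
          * ξ D ((y - 1ℚ) /ₜ (z - 1ℚ))
                (x * ((y - 1ℚ) /ₜ (z - 1ℚ)))
                (x * (((y - 1ℚ) * (y - 1ℚ)) /ₜ (z - 1ℚ))))
    × ((x y z : ℚ) → x ≢ 0ℚ → y ≢ 0ℚ →
      ξ D x y z
        ≡ pow x (nV D) * σπ D (y /ₜ x) ((y + z) /ₜ y) ((z /ₜ (x * y)) + 1ℚ))
theorem4p2 (digraph n es) = σπ′≡rescaled-ξ n es , ξ≡rescaled-σπ′ n es
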